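{- Let $m$ be a positive integer and $p$ a prime with $p>m$. Write $p=qm+r$ with $q=\lfloor p/m\rfloor$ and $0\le r<m$, write $\Phi_m=\sum_s a_sx^s$, and let $\Psi_m=(x^m-1)/\Phi_m$. Define the blocks $f_{m,p,i}$ ($0\le i\le\varphi(m)-1$) and $f_{m,p,i,j}$ ($0\le j\le q$) by $$\Phi_{mp}=\sum_{i=0}^{\varphi(m)-1}f_{m,p,i}\,x^{ip},\ \deg f_{m,p,i}<p,\qquad f_{m,p,i}=\sum_{j=0}^{q}f_{m,p,i,j}\,x^{jm},\ \deg f_{m,p,i,j}<m.$$ For a polynomial $h$ of degree $<m$ and $0\le s<m$ let $\mathcal{T}_s h=\operatorname{rem}(h,x^s)$ and $\mathcal{R}_{m,s}h=\operatorname{rem}(x^{m-s}h,\,x^m-1)$. Then: (1) $f_{m,p,i,j}=f_{m,p,i,0}$ for all $0\le i\le\varphi(m)-1$ and $0\le j\le q-1$; (2) $f_{m,p,i,q}=\mathcal{T}_r f_{m,p,i,0}$ for all $0\le i\le\varphi(m)-1$; (3) $f_{m,p,i+1,0}=\mathcal{R}_{m,r}f_{m,p,i,0}-a_{i+1}\Psi_m$ for all $0\le i\le\varphi(m)-2$.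
   Context: $\Phi_n$ is the $n$-th cyclotomic polynomial, $\varphi$ is Euler's totient function, and $\operatorname{rem}(a,b)$ denotes the remainder of polynomial division of $a$ by $b$. $\Psi_m$ is the $m$-th inverse cyclotomic polynomial. In coefficient terms, if $h=\sum_{k=0}^{m-1}h_kx^k$ then $\mathcal{T}_sh$ corresponds to $(h_0,\dots,h_{s-1})$ and $\mathcal{R}_{m,s}h$ to the cyclic rotation $(h_s,\dots,h_{m-1},h_0,\dots,h_{s-1})$. -}

module Defs where

open import Data.Nat as ℕ using (ℕ; zero; suc; _∸_; _≤ᵇ_)
open import Data.Nat.GCD using (gcd)
open import Data.Nat.Divisibility using (_∣?_)
open import Data.Integer as ℤ using (ℤ; 0ℤ; 1ℤ)
open import Data.List using (List; []; _∷_; _++_; [_]; map; foldr; reverse; length; upTo)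
open import Data.Product using (_×_; _,_; proj₁; proj₂)
open import Data.Bool using (Bool; true; false; if_then_else_; _∧_)
open import Relation.Nullary using (yes; no)
open import Relation.Nullary.Decidable using (⌊_⌋)
open import Relation.Binary.PropositionalEquality using (_≡_)

-- Polynomials over ℤ as coefficient lists, lowest degree first.
Poly : Set
Poly = List ℤ

coeff : Poly → ℕ → ℤ
coeff [] _ = 0ℤ
coeff (a ∷ _) zero = a
coeff (_ ∷ f) (suc k) = coeff f k

-- equality of polynomials (coefficientwise; insensitive to trailing zeros)
infix 4 _≈ₚ_
_≈ₚ_ : Poly → Poly → Set
f ≈ₚ g = ∀ k → coeff f k ≡ coeff g k

infixl 6 _+ₚ_ _-ₚ_
infixl 7 _*ₚ_

_+ₚ_ : Poly → Poly → Poly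
[] +ₚ g = g
(a ∷ f) +ₚ [] = a ∷ f
(a ∷ f) +ₚ (b ∷ g) = (a ℤ.+ b) ∷ (f +ₚ g)

scaleₚ : ℤ → Poly → Poly
scaleₚ c = map (c ℤ.*_)

negₚ : Poly → Poly
negₚ = map (λ a → ℤ.- a)

_-ₚ_ : Poly → Poly → Poly
f -ₚ g = f +ₚ negₚ g

_*ₚ_ : Poly → Poly → Poly
[] *ₚ g = []
(a ∷ f) *ₚ g = scaleₚ a g +ₚ (0ℤ ∷ (f *ₚ g))

oneₚ : Poly
oneₚ = 1ℤ ∷ []

monomial : ℕ → ℤ → Poly
monomial zero c = c ∷ []
monomial (suc n) c = 0ℤ ∷ monomial n c

xpow : ℕ → Poly
xpow n = monomial n 1ℤ

xpow-1 : ℕ → Poly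
xpow-1 n = xpow n -ₚ oneₚ

-- Euclidean division by a monic polynomial (long division).
-- Lists below are high-degree-first.

stripHigh : List ℤ → List ℤ
stripHigh [] = []
stripHigh (a ∷ l) with a ℤ.≟ 0ℤ
... | yes _ = stripHigh l
... | no _ = a ∷ l

subPre : ℤ → List ℤ → List ℤ → List ℤ
subPre c [] r = r
subPre c (g ∷ gs) [] = []
subPre c (g ∷ gs) (a ∷ r) = (a ℤ.- c ℤ.* g) ∷ subPre c gs r

-- fuel, lower coefficients of the monic divisor (high first), dividend (high first)
divLoop : ℕ → List ℤ → List ℤ → List ℤ × List ℤ
divLoop zero gs rf = [] , rf
divLoop (suc n) gs [] = [] , []
divLoop (suc n) gs (c ∷ rest) with length gs ≤ᵇ length rest
... | true  = let qr = divLoop n gs (subPre c gs rest) in (c ∷ proj₁ qr) , proj₂ qr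
... | false = [] , (c ∷ rest)

divModHelper : Poly → List ℤ → Poly × Poly
divModHelper f [] = [] , f
divModHelper f (_ ∷ gs) =
  let qr = divLoop (length f) gs (reverse f) in reverse (proj₁ qr) , reverse (proj₂ qr)

-- (quotient , remainder) of f by g; correct when g is monic (all uses below).
divModₚ : Poly → Poly → Poly × Poly
divModₚ f g = divModHelper f (stripHigh (reverse g))

quotₚ : Poly → Poly → Poly
quotₚ f g = proj₁ (divModₚ f g)

remₚ : Poly → Poly → Poly
remₚ f g = proj₂ (divModₚ f g)

-- Cyclotomic polynomials: Φ_n = (x^n - 1) / ∏_{d ∣ n, d < n} Φ_d  (n ≥ 1)

at : List Poly → ℕ → Poly
at [] _ = []
at (f ∷ _) zero = f
at (_ ∷ fs) (suc k) = at fs k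

-- tbl holds Φ_1 , … , Φ_{n-1}
properDivProd : List Poly → ℕ → Poly
properDivProd tbl n =
  foldr (λ d acc → if (1 ≤ᵇ d) ∧ ⌊ d ∣? n ⌋ then at tbl (d ∸ 1) *ₚ acc else acc)
        oneₚ (upTo n)

cycloTable : ℕ → List Poly
cycloTable zero = []
cycloTable (suc n) = cycloTable n ++ [ quotₚ (xpow-1 (suc n)) (properDivProd (cycloTable n) (suc n)) ]

Φ : ℕ → Poly
Φ n = at (cycloTable n) (n ∸ 1)

Ψ : ℕ → Poly
Ψ m = quotₚ (xpow-1 m) (Φ m)

countTrue : List Bool → ℕ
countTrue [] = 0
countTrue (true ∷ l) = suc (countTrue l)
countTrue (false ∷ l) = countTrue l

φ : ℕ → ℕ
φ n = countTrue (map (λ k → ⌊ gcd (suc k) n ℕ.≟ 1 ⌋) (upTo n))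

-- Blocks.  Φ_{mp} = Σ_i f_{m,p,i} x^{ip} with deg f_{m,p,i} < p, so the
-- coefficient of x^k in f_{m,p,i} (k < p) is that of x^{ip+k} in Φ_{mp}.
fBlock : ℕ → ℕ → ℕ → Poly
fBlock m p i = map (λ k → coeff (Φ (m ℕ.* p)) (i ℕ.* p ℕ.+ k)) (upTo p)

-- f_{m,p,i} = Σ_j f_{m,p,i,j} x^{jm} with deg f_{m,p,i,j} < m
fBlock2 : ℕ → ℕ → ℕ → ℕ → Poly
fBlock2 m p i j = map (λ k → coeff (fBlock m p i) (j ℕ.* m ℕ.+ k)) (upTo m)

𝒯 : ℕ → Poly → Poly
𝒯 s h = remₚ h (xpow s)

ℛ : ℕ → ℕ → Poly → Poly
ℛ m s h = remₚ (xpow (m ∸ s) *ₚ h) (xpow-1 m)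

-- Write c_k, a_i and ψ_t for the coefficients of Φ (m p), Φ m and Ψ m. Since p ∤ m,
-- Φ m (x^p) = Φ (m p) Φ m, hence Φ (m p) (x^m - 1) = Φ m (x^p) Ψ m. As deg Ψ m < m < p, the
-- coefficient of x^(i p + t) (t < p) on the right is a_i ψ_t, so c_(k + m) = c_k - a_i ψ_t whenever
-- k + m = i p + t. Inside a block (t ≥ m) this says that the coefficients are m-periodic, which gives
-- (1) and (2); passing to the next block (t < m) gives c_((i+1) p + t) = c_(i p + p - m + t) - a_(i+1) ψ_t,
-- which is (3).
-- Since Φ is defined by exact division, the cyclotomic facts used are proved from scratch:
-- x^n - 1 = ∏_{d ∣ n} Φ d with all factors monic (strong induction, using that distinct Φ d are
-- coprime because x^n - 1 is squarefree), then Φ m (x^p) = Φ (p m) Φ m for p ∤ m, and deg Φ n ≥ 1.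

module Submission where

open import Defs
open import Data.Nat as ℕ using (ℕ; zero; suc; _≤_; _<_; z≤n; s≤s; _∸_; _≤ᵇ_; NonZero; _/_; _%_)
import Data.Nat.Properties as ℕP
open import Data.Nat.Divisibility
  using (_∣_; _∣?_; divides; ∣-refl; ∣-trans; ∣⇒≤; 0∣⇒≡0; m∣m*n; ∣n⇒∣m*n; ∣m+n∣m⇒∣n; *-cancelˡ-∣; *-monoʳ-∣)
open import Data.Nat.DivMod using (m≡m%n+[m/n]*n; m%n<n)
open import Data.Nat.GCD using (gcd; gcd-GCD; gcd[m,n]∣m; gcd-comm; module Bézout)
open import Data.Nat.Coprimality using (Coprime; coprime-divisor)
open import Data.Nat.Primality using (Prime; prime?; prime⇒irreducible; prime⇒nonZero; prime⇒nonTrivial; ¬prime⇒composite)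
open import Data.Nat.Base using (n>1⇒nonTrivial; nonTrivial⇒n>1)
open import Data.Nat.Divisibility.Core using (hasNonTrivialDivisor)
open import Data.Nat.Induction using (<-rec)
import Data.Nat.Tactic.RingSolver as ℕ-Solver
open import Data.Integer as ℤ using (ℤ; 0ℤ; 1ℤ; +_)
import Data.Integer.Properties as ℤP
import Data.Integer.Tactic.RingSolver as ℤ-Solver
open import Data.List using (List; []; _∷_; [_]; _++_; length; reverse; foldr; map; upTo; applyUpTo; take; drop)
import Data.List.Properties as ListP
open import Data.Bool using (Bool; true; false; T; if_then_else_; _∧_; not)
import Data.Bool.Properties as BoolP
open import Data.Unit using (tt)
open import Data.Maybe using (Maybe; just; nothing)
open import Data.Empty using (⊥-elim)
open import Data.Sum using (_⊎_; inj₁; inj₂)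
open import Data.Product using (Σ; _×_; _,_; proj₁; proj₂)
open import Relation.Nullary using (¬_; Dec; yes; no)
open import Relation.Nullary.Decidable using (⌊_⌋)
open import Relation.Binary.Definitions using (tri<; tri≈; tri>)
open import Relation.Binary.Structures using (IsEquivalence)
open import Relation.Binary.PropositionalEquality hiding ([_])
open import Algebra.Bundles using (CommutativeRing)
open import Tactic.RingSolver.Core.AlmostCommutativeRing using (AlmostCommutativeRing; fromCommutativeRing)
open import Tactic.RingSolver using (solve-∀)

-- Polynomial arithmetic

-- A record, so that f and g can be inferred from a proof of f ≋ g.
infix 4 _≋_
record _≋_ (f g : Poly) : Set where
  constructor coeffwise
  field coeff≡ : f ≈ₚ g
open _≋_ public

≋-refl : ∀ {f} → f ≋ f
≋-refl = coeffwise λ _ → refl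

≋-sym : ∀ {f g} → f ≋ g → g ≋ f
≋-sym (coeffwise e) = coeffwise λ k → sym (e k)

≋-trans : ∀ {f g h} → f ≋ g → g ≋ h → f ≋ h
≋-trans (coeffwise e) (coeffwise e′) = coeffwise λ k → trans (e k) (e′ k)

infixr 2 _⟨≋⟩_
_⟨≋⟩_ : ∀ {f g h} → f ≋ g → g ≋ h → f ≋ h
_⟨≋⟩_ = ≋-trans

≡⇒≋ : ∀ {f g} → f ≡ g → f ≋ g
≡⇒≋ refl = ≋-refl

coeff-+ : ∀ f g k → coeff (f +ₚ g) k ≡ coeff f k ℤ.+ coeff g k
coeff-+ [] g k = sym (ℤP.+-identityˡ _)
coeff-+ (a ∷ f) [] k = sym (ℤP.+-identityʳ _)
coeff-+ (a ∷ f) (b ∷ g) zero = refl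
coeff-+ (a ∷ f) (b ∷ g) (suc k) = coeff-+ f g k

coeff-scale : ∀ a f k → coeff (scaleₚ a f) k ≡ a ℤ.* coeff f k
coeff-scale a [] k = sym (ℤP.*-zeroʳ a)
coeff-scale a (b ∷ f) zero = refl
coeff-scale a (b ∷ f) (suc k) = coeff-scale a f k

coeff-neg : ∀ f k → coeff (negₚ f) k ≡ ℤ.- coeff f k
coeff-neg [] k = refl
coeff-neg (b ∷ f) zero = refl
coeff-neg (b ∷ f) (suc k) = coeff-neg f k

coeff-- : ∀ f g k → coeff (f -ₚ g) k ≡ coeff f k ℤ.- coeff g k
coeff-- f g k = trans (coeff-+ f (negₚ g) k) (cong (ℤ._+_ (coeff f k)) (coeff-neg g k))

coeff-∷-* : ∀ c f g k → coeff ((c ∷ f) *ₚ g) k ≡ c ℤ.* coeff g k ℤ.+ coeff (0ℤ ∷ (f *ₚ g)) k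
coeff-∷-* c f g k = trans (coeff-+ (scaleₚ c g) (0ℤ ∷ (f *ₚ g)) k) (cong (ℤ._+ coeff (0ℤ ∷ (f *ₚ g)) k) (coeff-scale c g k))

+-cong : ∀ {f f′ g g′} → f ≋ f′ → g ≋ g′ → f +ₚ g ≋ f′ +ₚ g′
+-cong {f} {f′} {g} {g′} (coeffwise e) (coeffwise e′) =
  coeffwise λ k → trans (coeff-+ f g k) (trans (cong₂ ℤ._+_ (e k) (e′ k)) (sym (coeff-+ f′ g′ k)))

neg-cong : ∀ {f f′} → f ≋ f′ → negₚ f ≋ negₚ f′
neg-cong {f} {f′} (coeffwise e) = coeffwise λ k → trans (coeff-neg f k) (trans (cong ℤ.-_ (e k)) (sym (coeff-neg f′ k)))

scale-cong : ∀ a {f f′} → f ≋ f′ → scaleₚ a f ≋ scaleₚ a f′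
scale-cong a {f} {f′} (coeffwise e) =
  coeffwise λ k → trans (coeff-scale a f k) (trans (cong (a ℤ.*_) (e k)) (sym (coeff-scale a f′ k)))

∷-cong : ∀ {a b f g} → a ≡ b → f ≋ g → a ∷ f ≋ b ∷ g
∷-cong e (coeffwise e′) = coeffwise λ { zero → e ; (suc k) → e′ k }

0∷-zero : ∀ {f} → f ≋ [] → 0ℤ ∷ f ≋ []
0∷-zero (coeffwise e) = coeffwise λ { zero → refl ; (suc k) → e k }

+-comm : ∀ f g → f +ₚ g ≋ g +ₚ f
+-comm f g = coeffwise λ k → trans (coeff-+ f g k) (trans (ℤP.+-comm (coeff f k) (coeff g k)) (sym (coeff-+ g f k)))

+-assoc : ∀ f g h → (f +ₚ g) +ₚ h ≋ f +ₚ (g +ₚ h)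
+-assoc f g h = coeffwise λ k → begin
  coeff ((f +ₚ g) +ₚ h) k                  ≡⟨ coeff-+ (f +ₚ g) h k ⟩
  coeff (f +ₚ g) k ℤ.+ coeff h k           ≡⟨ cong (ℤ._+ coeff h k) (coeff-+ f g k) ⟩
  (coeff f k ℤ.+ coeff g k) ℤ.+ coeff h k  ≡⟨ ℤP.+-assoc (coeff f k) (coeff g k) (coeff h k) ⟩
  coeff f k ℤ.+ (coeff g k ℤ.+ coeff h k)  ≡⟨ cong (ℤ._+_ (coeff f k)) (coeff-+ g h k) ⟨
  coeff f k ℤ.+ coeff (g +ₚ h) k           ≡⟨ coeff-+ f (g +ₚ h) k ⟨
  coeff (f +ₚ (g +ₚ h)) k                  ∎
  where open ≡-Reasoning

+-identityˡ : ∀ f → [] +ₚ f ≋ f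
+-identityˡ f = ≋-refl

+-identityʳ : ∀ f → f +ₚ [] ≋ f
+-identityʳ f = coeffwise λ k → trans (coeff-+ f [] k) (ℤP.+-identityʳ _)

-‿inverseˡ : ∀ f → negₚ f +ₚ f ≋ []
-‿inverseˡ f = coeffwise λ k →
  trans (coeff-+ (negₚ f) f k) (trans (cong (ℤ._+ coeff f k) (coeff-neg f k)) (ℤP.+-inverseˡ (coeff f k)))

-‿inverseʳ : ∀ f → f +ₚ negₚ f ≋ []
-‿inverseʳ f = +-comm f (negₚ f) ⟨≋⟩ -‿inverseˡ f

+-interchange : ∀ f g h k → (f +ₚ g) +ₚ (h +ₚ k) ≋ (f +ₚ h) +ₚ (g +ₚ k)
+-interchange f g h k = coeffwise λ i → begin
  coeff ((f +ₚ g) +ₚ (h +ₚ k)) i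
    ≡⟨ trans (coeff-+ (f +ₚ g) (h +ₚ k) i) (cong₂ ℤ._+_ (coeff-+ f g i) (coeff-+ h k i)) ⟩
  (coeff f i ℤ.+ coeff g i) ℤ.+ (coeff h i ℤ.+ coeff k i)
    ≡⟨ interchange (coeff f i) (coeff g i) (coeff h i) (coeff k i) ⟩
  (coeff f i ℤ.+ coeff h i) ℤ.+ (coeff g i ℤ.+ coeff k i)
    ≡⟨ trans (coeff-+ (f +ₚ h) (g +ₚ k) i) (cong₂ ℤ._+_ (coeff-+ f h i) (coeff-+ g k i)) ⟨
  coeff ((f +ₚ h) +ₚ (g +ₚ k)) i ∎
  where
  open ≡-Reasoning
  interchange : ∀ x y z w → (x ℤ.+ y) ℤ.+ (z ℤ.+ w) ≡ (x ℤ.+ z) ℤ.+ (y ℤ.+ w)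
  interchange = ℤ-Solver.solve-∀

scale-distribʳ : ∀ a b h → scaleₚ (a ℤ.+ b) h ≋ scaleₚ a h +ₚ scaleₚ b h
scale-distribʳ a b h = coeffwise λ k →
  trans (coeff-scale (a ℤ.+ b) h k) (trans (ℤP.*-distribʳ-+ (coeff h k) a b)
    (sym (trans (coeff-+ (scaleₚ a h) (scaleₚ b h) k) (cong₂ ℤ._+_ (coeff-scale a h k) (coeff-scale b h k)))))

scale-distribˡ : ∀ a f g → scaleₚ a (f +ₚ g) ≋ scaleₚ a f +ₚ scaleₚ a g
scale-distribˡ a f g = coeffwise λ k →
  trans (coeff-scale a (f +ₚ g) k) (trans (cong (a ℤ.*_) (coeff-+ f g k)) (trans (ℤP.*-distribˡ-+ a (coeff f k) (coeff g k))
    (sym (trans (coeff-+ (scaleₚ a f) (scaleₚ a g) k) (cong₂ ℤ._+_ (coeff-scale a f k) (coeff-scale a g k))))))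

scale-assoc : ∀ a b h → scaleₚ (a ℤ.* b) h ≋ scaleₚ a (scaleₚ b h)
scale-assoc a b h = coeffwise λ k →
  trans (coeff-scale (a ℤ.* b) h k) (trans (ℤP.*-assoc a b (coeff h k))
    (sym (trans (coeff-scale a (scaleₚ b h) k) (cong (a ℤ.*_) (coeff-scale b h k)))))

scale-zeroˡ : ∀ h → scaleₚ 0ℤ h ≋ []
scale-zeroˡ h = coeffwise λ k → trans (coeff-scale 0ℤ h k) (ℤP.*-zeroˡ (coeff h k))

scale-identityˡ : ∀ h → scaleₚ 1ℤ h ≋ h
scale-identityˡ h = coeffwise λ k → trans (coeff-scale 1ℤ h k) (ℤP.*-identityˡ (coeff h k))

*-zeroʳ : ∀ f → f *ₚ [] ≋ []
*-zeroʳ [] = ≋-refl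
*-zeroʳ (a ∷ f) = 0∷-zero (*-zeroʳ f)

*-congʳ : ∀ f {g g′} → g ≋ g′ → f *ₚ g ≋ f *ₚ g′
*-congʳ [] e = ≋-refl
*-congʳ (a ∷ f) e = +-cong (scale-cong a e) (∷-cong refl (*-congʳ f e))

*-∷ʳ : ∀ f b g → f *ₚ (b ∷ g) ≋ scaleₚ b f +ₚ (0ℤ ∷ (f *ₚ g))
*-∷ʳ [] b g = coeffwise λ { zero → refl ; (suc k) → refl }
*-∷ʳ (a ∷ f) b g = coeffwise λ
  { zero → trans (coeff-+ (scaleₚ a (b ∷ g)) (0ℤ ∷ (f *ₚ (b ∷ g))) zero)
             (trans (cong (ℤ._+ 0ℤ) (ℤP.*-comm a b)) (sym (coeff-+ (scaleₚ b (a ∷ f)) (0ℤ ∷ ((a ∷ f) *ₚ g)) zero)))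
  ; (suc k) → begin
      coeff ((a ∷ f) *ₚ (b ∷ g)) (suc k)
        ≡⟨ coeff-∷-* a f (b ∷ g) (suc k) ⟩
      a ℤ.* coeff g k ℤ.+ coeff (f *ₚ (b ∷ g)) k
        ≡⟨ cong (ℤ._+_ (a ℤ.* coeff g k)) (trans (coeff≡ (*-∷ʳ f b g) k) (coeff-+ (scaleₚ b f) (0ℤ ∷ (f *ₚ g)) k)) ⟩
      a ℤ.* coeff g k ℤ.+ (coeff (scaleₚ b f) k ℤ.+ coeff (0ℤ ∷ (f *ₚ g)) k)
        ≡⟨ swap (a ℤ.* coeff g k) (coeff (scaleₚ b f) k) (coeff (0ℤ ∷ (f *ₚ g)) k) ⟩
      coeff (scaleₚ b f) k ℤ.+ (a ℤ.* coeff g k ℤ.+ coeff (0ℤ ∷ (f *ₚ g)) k)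
        ≡⟨ cong (ℤ._+_ (coeff (scaleₚ b f) k)) (coeff-∷-* a f g k) ⟨
      coeff (scaleₚ b f) k ℤ.+ coeff ((a ∷ f) *ₚ g) k
        ≡⟨ coeff-+ (scaleₚ b (a ∷ f)) (0ℤ ∷ ((a ∷ f) *ₚ g)) (suc k) ⟨
      coeff (scaleₚ b (a ∷ f) +ₚ (0ℤ ∷ ((a ∷ f) *ₚ g))) (suc k) ∎ }
  where
  open ≡-Reasoning
  swap : ∀ x y z → x ℤ.+ (y ℤ.+ z) ≡ y ℤ.+ (x ℤ.+ z)
  swap = ℤ-Solver.solve-∀

*-comm : ∀ f g → f *ₚ g ≋ g *ₚ f
*-comm f [] = *-zeroʳ f
*-comm f (b ∷ g) = *-∷ʳ f b g ⟨≋⟩ +-cong ≋-refl (∷-cong refl (*-comm f g))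

*-congˡ : ∀ {f f′} g → f ≋ f′ → f *ₚ g ≋ f′ *ₚ g
*-congˡ {f} {f′} g e = *-comm f g ⟨≋⟩ *-congʳ g e ⟨≋⟩ *-comm g f′

*-cong : ∀ {f f′ g g′} → f ≋ f′ → g ≋ g′ → f *ₚ g ≋ f′ *ₚ g′
*-cong {f′ = f′} {g = g} e e′ = *-congˡ g e ⟨≋⟩ *-congʳ f′ e′

*-distribʳ : ∀ h f g → (f +ₚ g) *ₚ h ≋ f *ₚ h +ₚ g *ₚ h
*-distribʳ h [] g = ≋-refl
*-distribʳ h (a ∷ f) [] = ≋-sym (+-identityʳ _)
*-distribʳ h (a ∷ f) (b ∷ g) =
  +-cong (scale-distribʳ a b h) (∷-cong refl (*-distribʳ h f g))
  ⟨≋⟩ +-interchange (scaleₚ a h) (scaleₚ b h) (0ℤ ∷ (f *ₚ h)) (0ℤ ∷ (g *ₚ h))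

*-distribˡ : ∀ h f g → h *ₚ (f +ₚ g) ≋ h *ₚ f +ₚ h *ₚ g
*-distribˡ h f g = *-comm h (f +ₚ g) ⟨≋⟩ *-distribʳ h f g ⟨≋⟩ +-cong (*-comm f h) (*-comm g h)

0∷-* : ∀ f h → (0ℤ ∷ f) *ₚ h ≋ 0ℤ ∷ (f *ₚ h)
0∷-* f h = +-cong (scale-zeroˡ h) ≋-refl

scale-* : ∀ a g h → scaleₚ a g *ₚ h ≋ scaleₚ a (g *ₚ h)
scale-* a [] h = ≋-refl
scale-* a (b ∷ g) h =
  +-cong (scale-assoc a b h) (∷-cong refl (scale-* a g h))
  ⟨≋⟩ +-cong ≋-refl (≋-sym (∷-cong (ℤP.*-zeroʳ a) ≋-refl))
  ⟨≋⟩ ≋-sym (scale-distribˡ a (scaleₚ b h) (0ℤ ∷ (g *ₚ h)))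

*-assoc : ∀ f g h → (f *ₚ g) *ₚ h ≋ f *ₚ (g *ₚ h)
*-assoc [] g h = ≋-refl
*-assoc (a ∷ f) g h =
  *-distribʳ h (scaleₚ a g) (0ℤ ∷ (f *ₚ g))
  ⟨≋⟩ +-cong (scale-* a g h) (0∷-* (f *ₚ g) h ⟨≋⟩ ∷-cong refl (*-assoc f g h))

*-identityˡ : ∀ f → oneₚ *ₚ f ≋ f
*-identityˡ f = +-cong (scale-identityˡ f) (0∷-zero ≋-refl) ⟨≋⟩ +-identityʳ f

*-identityʳ : ∀ f → f *ₚ oneₚ ≋ f
*-identityʳ f = *-comm f oneₚ ⟨≋⟩ *-identityˡ f

≋-isEquivalence : IsEquivalence _≋_
≋-isEquivalence = record { refl = ≋-refl ; sym = ≋-sym ; trans = ≋-trans }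

Poly-commutativeRing : CommutativeRing _ _
Poly-commutativeRing = record
  { Carrier = Poly ; _≈_ = _≋_ ; _+_ = _+ₚ_ ; _*_ = _*ₚ_ ; -_ = negₚ ; 0# = [] ; 1# = oneₚ
  ; isCommutativeRing = record
    { isRing = record
      { +-isAbelianGroup = record
        { isGroup = record
          { isMonoid = record
            { isSemigroup = record
              { isMagma = record { isEquivalence = ≋-isEquivalence ; ∙-cong = +-cong }
              ; assoc = +-assoc }
            ; identity = +-identityˡ , +-identityʳ }
          ; inverse = -‿inverseˡ , -‿inverseʳ
          ; ⁻¹-cong = neg-cong }
        ; comm = +-comm }
      ; *-cong = *-cong
      ; *-assoc = *-assoc
      ; *-identity = *-identityˡ , *-identityʳ
      ; distrib = *-distribˡ , *-distribʳ }
    ; *-comm = *-comm } }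

≋[]? : (f : Poly) → Maybe ([] ≋ f)
≋[]? [] = just ≋-refl
≋[]? (a ∷ f) with a ℤ.≟ 0ℤ | ≋[]? f
... | yes refl | just (coeffwise e) = just (coeffwise λ { zero → refl ; (suc k) → e k })
... | _        | _                  = nothing

Poly-ring : AlmostCommutativeRing _ _
Poly-ring = fromCommutativeRing Poly-commutativeRing ≋[]?

-- Degree bounds and monic polynomials

record Deg< (f : Poly) (n : ℕ) : Set where
  constructor deg<
  field vanish : ∀ k → n ≤ k → coeff f k ≡ 0ℤ
open Deg< public

Monic : Poly → ℕ → Set
Monic f n = coeff f n ≡ 1ℤ × Deg< f (suc n)

1≢0 : 1ℤ ≢ 0ℤ
1≢0 ()

Deg<-length : ∀ f → Deg< f (length f)
Deg<-length f = deg< (go f)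
  where
  go : ∀ f k → length f ≤ k → coeff f k ≡ 0ℤ
  go [] k _ = refl
  go (a ∷ f) (suc k) (s≤s le) = go f k le

Deg<-resp : ∀ {f g n} → f ≋ g → Deg< f n → Deg< g n
Deg<-resp (coeffwise e) (deg< d) = deg< λ k le → trans (sym (e k)) (d k le)

Deg<-mono : ∀ {f m n} → m ≤ n → Deg< f m → Deg< f n
Deg<-mono le (deg< d) = deg< λ k le′ → d k (ℕP.≤-trans le le′)

Deg<-lower : ∀ {f n} → Deg< f (suc n) → coeff f n ≡ 0ℤ → Deg< f n
Deg<-lower {f} {n} df e = deg< go
  where
  go : ∀ k → n ≤ k → coeff f k ≡ 0ℤ
  go k le with ℕP.m≤n⇒m<n∨m≡n le
  ... | inj₁ lt = vanish df k lt
  ... | inj₂ refl = e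

Deg<-0 : ∀ {f} → Deg< f 0 → f ≋ []
Deg<-0 (deg< d) = coeffwise λ k → d k z≤n

Deg<-tail : ∀ {c f n} → Deg< (c ∷ f) (suc n) → Deg< f n
Deg<-tail (deg< d) = deg< λ k le → d (suc k) (s≤s le)

Deg<-+ : ∀ {f g n} → Deg< f n → Deg< g n → Deg< (f +ₚ g) n
Deg<-+ {f} {g} df dg = deg< λ k le → trans (coeff-+ f g k) (cong₂ ℤ._+_ (vanish df k le) (vanish dg k le))

Deg<-neg : ∀ {f n} → Deg< f n → Deg< (negₚ f) n
Deg<-neg {f} df = deg< λ k le → trans (coeff-neg f k) (cong ℤ.-_ (vanish df k le))

Monic-resp : ∀ {f g n} → f ≋ g → Monic f n → Monic g n
Monic-resp e (c , d) = trans (sym (coeff≡ e _)) c , Deg<-resp e d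

Monic-degree-unique : ∀ {f a b} → Monic f a → Monic f b → a ≡ b
Monic-degree-unique {f} {a} {b} (ca , da) (cb , db) with ℕP.<-cmp a b
... | tri< lt _ _ = ⊥-elim (1≢0 (trans (sym cb) (vanish da b lt)))
... | tri≈ _ e _ = e
... | tri> _ _ gt = ⊥-elim (1≢0 (trans (sym ca) (vanish db a gt)))

Deg<-* : ∀ f g a b → Deg< f (suc a) → Deg< g (suc b) → Deg< (f *ₚ g) (suc (a ℕ.+ b))
Deg<-* f g a b df dg = deg< (go f a df)
  where
  go : ∀ f a → Deg< f (suc a) → ∀ k → suc (a ℕ.+ b) ≤ k → coeff (f *ₚ g) k ≡ 0ℤ
  go [] a df k le = refl
  go (c ∷ f) a df (suc k) (s≤s le) =
    trans (coeff-∷-* c f g (suc k))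
      (trans (cong₂ ℤ._+_ (trans (cong (c ℤ.*_) (vanish dg (suc k) (s≤s (ℕP.≤-trans (ℕP.m≤n+m b a) le)))) (ℤP.*-zeroʳ c))
                          (tail a df k le))
             (ℤP.+-identityˡ _))
    where
    tail : ∀ a → Deg< (c ∷ f) (suc a) → ∀ k → a ℕ.+ b ≤ k → coeff (f *ₚ g) k ≡ 0ℤ
    tail zero df k le = coeff≡ (*-congˡ g (Deg<-0 (Deg<-tail df))) k
    tail (suc a) df (suc k) (s≤s le) = go f a (Deg<-tail df) (suc k) (s≤s le)

coeff-*-top : ∀ f g a b → Deg< f (suc a) → Deg< g (suc b) → coeff (f *ₚ g) (a ℕ.+ b) ≡ coeff f a ℤ.* coeff g b
coeff-*-top [] g a b df dg = refl
coeff-*-top (c ∷ f) g zero b df dg =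
  trans (coeff-∷-* c f g b) (trans (cong (ℤ._+_ (c ℤ.* coeff g b)) (lower-vanish b)) (ℤP.+-identityʳ _))
  where
  lower-vanish : ∀ b → coeff (0ℤ ∷ (f *ₚ g)) b ≡ 0ℤ
  lower-vanish zero = refl
  lower-vanish (suc b) = coeff≡ (*-congˡ g (Deg<-0 (Deg<-tail df))) b
coeff-*-top (c ∷ f) g (suc a) b df dg =
  trans (coeff-∷-* c f g (suc (a ℕ.+ b)))
    (trans (cong₂ ℤ._+_ (trans (cong (c ℤ.*_) (vanish dg (suc (a ℕ.+ b)) (s≤s (ℕP.m≤n+m b a)))) (ℤP.*-zeroʳ c))
                        (coeff-*-top f g a b (Deg<-tail df) dg))
           (ℤP.+-identityˡ _))

coeff-*-monic-top : ∀ f g a b → Deg< f (suc a) → Monic g b → coeff (f *ₚ g) (a ℕ.+ b) ≡ coeff f a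
coeff-*-monic-top f g a b df (cg , dg) =
  trans (coeff-*-top f g a b df dg) (trans (cong (coeff f a ℤ.*_) cg) (ℤP.*-identityʳ _))

Monic-* : ∀ {f g a b} → Monic f a → Monic g b → Monic (f *ₚ g) (a ℕ.+ b)
Monic-* {f} {g} {a} {b} (cf , df) (cg , dg) = trans (coeff-*-monic-top f g a b df (cg , dg)) cf , Deg<-* f g a b df dg

-- The leading coefficient of A g is that of A.
*-monic-Deg<⇒≋[] : ∀ {g N} A → Monic g N → Deg< (A *ₚ g) N → A ≋ []
*-monic-Deg<⇒≋[] {g} {N} A mg dAg = go (length A) (Deg<-length A)
  where
  go : ∀ L → Deg< A L → A ≋ []
  go zero dA = Deg<-0 dA
  go (suc L) dA = go L (Deg<-lower dA (trans (sym (coeff-*-monic-top A g L N dA mg)) (vanish dAg (L ℕ.+ N) (ℕP.m≤n+m N L))))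

*-cancelˡ-Monic : ∀ {A X Y k} → Monic A k → A *ₚ X ≋ A *ₚ Y → X ≋ Y
*-cancelˡ-Monic {A} {X} {Y} mA e = difference X Y ⟨≋⟩ +-cong X-Y≋[] (≋-refl {Y})
  where
  difference : ∀ X Y → X ≋ (X -ₚ Y) +ₚ Y
  difference = solve-∀ Poly-ring
  factor : ∀ X Y A → (X -ₚ Y) *ₚ A ≋ A *ₚ X -ₚ A *ₚ Y
  factor = solve-∀ Poly-ring
  X-Y≋[] : X -ₚ Y ≋ []
  X-Y≋[] = *-monic-Deg<⇒≋[] (X -ₚ Y) mA
             (Deg<-resp (≋-sym (factor X Y A ⟨≋⟩ +-cong e (≋-refl {negₚ (A *ₚ Y)}) ⟨≋⟩ -‿inverseʳ (A *ₚ Y))) (deg< λ _ _ → refl))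

Monic-cofactor : ∀ {f n P a} Q → Monic f n → f ≋ Q *ₚ P → Monic P a → Monic Q (n ∸ a) × a ≤ n
Monic-cofactor {f} {n} {P} {a} Q (cf , df) e mP@(cP , dP) = go (length Q) (Deg<-length Q)
  where
  go : ∀ L → Deg< Q L → Monic Q (n ∸ a) × a ≤ n
  go zero dQ = ⊥-elim (1≢0 (trans (sym cf) (trans (coeff≡ e n) (coeff≡ (*-congˡ P (Deg<-0 dQ)) n))))
  go (suc L) dQ with coeff Q L ℤ.≟ 0ℤ
  ... | yes z = go L (Deg<-lower dQ z)
  ... | no nz with ℕP.<-cmp (L ℕ.+ a) n
  ...   | tri< lt _ _ = ⊥-elim (1≢0 (trans (sym cf) (trans (coeff≡ e n) (vanish (Deg<-* Q P L a dQ dP) n lt))))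
  ...   | tri> _ _ gt =
          ⊥-elim (nz (trans (sym (coeff-*-monic-top Q P L a dQ mP)) (trans (sym (coeff≡ e (L ℕ.+ a))) (vanish df (L ℕ.+ a) gt))))
  ...   | tri≈ _ eq _ =
          subst (Monic Q) (sym (trans (cong (_∸ a) (sym eq)) (ℕP.m+n∸n≡m L a)))
            (trans (sym (coeff-*-monic-top Q P L a dQ mP)) (trans (sym (coeff≡ e (L ℕ.+ a))) (trans (cong (coeff f) eq) cf)) , dQ)
          , subst (a ≤_) eq (ℕP.m≤n+m a L)

-- Long division

const : ℤ → Poly
const c = c ∷ []

scale≋const-* : ∀ c f → scaleₚ c f ≋ const c *ₚ f
scale≋const-* c f = ≋-sym (+-cong ≋-refl (0∷-zero ≋-refl) ⟨≋⟩ +-identityʳ _)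

coeff-const-* : ∀ a f k → coeff (const a *ₚ f) k ≡ a ℤ.* coeff f k
coeff-const-* a f k = trans (sym (coeff≡ (scale≋const-* a f) k)) (coeff-scale a f k)

const-* : ∀ a b → const (a ℤ.* b) ≋ const a *ₚ const b
const-* a b = coeffwise λ { zero → sym (ℤP.+-identityʳ _) ; (suc k) → refl }

const-0 : const 0ℤ ≋ []
const-0 = coeffwise λ { zero → refl ; (suc k) → refl }

monomial≋xpow-* : ∀ n c → monomial n c ≋ xpow n *ₚ const c
monomial≋xpow-* zero c = ≋-sym (*-identityʳ (const c)) ⟨≋⟩ *-comm (const c) oneₚ
monomial≋xpow-* (suc n) c = ∷-cong refl (monomial≋xpow-* n c) ⟨≋⟩ ≋-sym (0∷-* (xpow n) (const c))

xpow-+ : ∀ a b → xpow (a ℕ.+ b) ≋ xpow a *ₚ xpow b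
xpow-+ zero b = ≋-sym (*-identityˡ (xpow b))
xpow-+ (suc a) b = ∷-cong refl (xpow-+ a b) ⟨≋⟩ ≋-sym (0∷-* (xpow a) (xpow b))

coeff-monomial-≡ : ∀ n c → coeff (monomial n c) n ≡ c
coeff-monomial-≡ zero c = refl
coeff-monomial-≡ (suc n) c = coeff-monomial-≡ n c

coeff-monomial-≢ : ∀ n c k → k ≢ n → coeff (monomial n c) k ≡ 0ℤ
coeff-monomial-≢ zero c zero ne = ⊥-elim (ne refl)
coeff-monomial-≢ zero c (suc k) ne = refl
coeff-monomial-≢ (suc n) c zero ne = refl
coeff-monomial-≢ (suc n) c (suc k) ne = coeff-monomial-≢ n c k (λ e → ne (cong suc e))

monomial-0 : ∀ n → monomial n 0ℤ ≋ []
monomial-0 zero = const-0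
monomial-0 (suc n) = 0∷-zero (monomial-0 n)

Monic-xpow : ∀ s → Monic (xpow s) s
Monic-xpow s = coeff-monomial-≡ s 1ℤ , deg< λ k le → coeff-monomial-≢ s 1ℤ k (λ e → ℕP.<⇒≢ le (sym e))

Monic-oneₚ : Monic oneₚ 0
Monic-oneₚ = Monic-xpow 0

Monic-xpow-1 : ∀ n → 1 ≤ n → Monic (xpow-1 n) n
Monic-xpow-1 (suc n) _ =
  trans (coeff-- (xpow (suc n)) oneₚ (suc n)) (cong (ℤ._- 0ℤ) (coeff-monomial-≡ (suc n) 1ℤ))
  , deg< λ { (suc (suc k)) (s≤s le) → trans (coeff-- (xpow (suc n)) oneₚ (suc (suc k)))
               (cong (ℤ._- 0ℤ) (coeff-monomial-≢ (suc n) 1ℤ (suc (suc k)) (λ e → ℕP.<⇒≢ (s≤s le) (sym e)))) }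

-- The polynomial whose coefficient list is given highest degree first, as divLoop consumes it.
fromHigh : List ℤ → Poly
fromHigh [] = []
fromHigh (c ∷ l) = monomial (length l) c +ₚ fromHigh l

snoc≋+monomial : ∀ f c → f ++ [ c ] ≋ f +ₚ monomial (length f) c
snoc≋+monomial [] c = ≋-refl
snoc≋+monomial (a ∷ f) c = ∷-cong (sym (ℤP.+-identityʳ a)) (snoc≋+monomial f c)

reverse≋fromHigh : ∀ l → reverse l ≋ fromHigh l
reverse≋fromHigh [] = ≋-refl
reverse≋fromHigh (c ∷ l) rewrite ListP.unfold-reverse c l =
  snoc≋+monomial (reverse l) c
  ⟨≋⟩ +-cong (reverse≋fromHigh l) (≡⇒≋ (cong (λ n → monomial n c) (ListP.length-reverse l)))
  ⟨≋⟩ +-comm (fromHigh l) (monomial (length l) c)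

≋fromHigh-reverse : ∀ f → f ≋ fromHigh (reverse f)
≋fromHigh-reverse f = subst (_≋ fromHigh (reverse f)) (ListP.reverse-involutive f) (reverse≋fromHigh (reverse f))

fromHigh-stripHigh : ∀ l → fromHigh (stripHigh l) ≋ fromHigh l
fromHigh-stripHigh [] = ≋-refl
fromHigh-stripHigh (a ∷ l) with a ℤ.≟ 0ℤ
... | yes refl = fromHigh-stripHigh l ⟨≋⟩ ≋-sym (+-cong (monomial-0 (length l)) ≋-refl)
... | no _ = ≋-refl

stripHigh-view : ∀ l → stripHigh l ≡ [] ⊎ Σ ℤ λ a → Σ (List ℤ) λ t → stripHigh l ≡ a ∷ t × a ≢ 0ℤ
stripHigh-view [] = inj₁ refl
stripHigh-view (a ∷ l) with a ℤ.≟ 0ℤ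
... | yes refl = stripHigh-view l
... | no ne = inj₂ (a , l , refl , ne)

Deg<-fromHigh : ∀ l → Deg< (fromHigh l) (length l)
Deg<-fromHigh [] = deg< λ k _ → refl
Deg<-fromHigh (c ∷ l) = deg< λ k le → trans (coeff-+ (monomial (length l) c) (fromHigh l) k)
  (cong₂ ℤ._+_ (coeff-monomial-≢ (length l) c k (λ e → ℕP.<⇒≢ le (sym e))) (vanish (Deg<-fromHigh l) k (ℕP.≤-trans (ℕP.n≤1+n _) le)))

coeff-fromHigh-top : ∀ c l → coeff (fromHigh (c ∷ l)) (length l) ≡ c
coeff-fromHigh-top c l = trans (coeff-+ (monomial (length l) c) (fromHigh l) (length l))
  (trans (cong₂ ℤ._+_ (coeff-monomial-≡ (length l) c) (vanish (Deg<-fromHigh l) (length l) ℕP.≤-refl)) (ℤP.+-identityʳ c))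

fromHigh-view : ∀ g {l} → stripHigh (reverse g) ≡ l → g ≋ fromHigh l
fromHigh-view g e = subst (λ z → g ≋ fromHigh z) e (≋fromHigh-reverse g ⟨≋⟩ ≋-sym (fromHigh-stripHigh (reverse g)))

Monic-stripHigh : ∀ g N → Monic g N → Σ (List ℤ) λ gs → stripHigh (reverse g) ≡ 1ℤ ∷ gs × length gs ≡ N
Monic-stripHigh g N (cg , dg) with stripHigh-view (reverse g)
... | inj₁ e = ⊥-elim (1≢0 (trans (sym cg) (coeff≡ (fromHigh-view g e) N)))
... | inj₂ (a , t , e , ne) with ℕP.<-cmp (length t) N
...   | tri< lt _ _ = ⊥-elim (1≢0 (trans (sym cg) (trans (coeff≡ (fromHigh-view g e) N) (vanish (Deg<-fromHigh (a ∷ t)) N lt))))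
...   | tri> _ _ gt = ⊥-elim (ne (trans (sym (coeff-fromHigh-top a t)) (trans (sym (coeff≡ (fromHigh-view g e) (length t))) (vanish dg (length t) gt))))
...   | tri≈ _ eq _ = t , trans e (cong (_∷ t) a≡1) , eq
  where
  a≡1 : a ≡ 1ℤ
  a≡1 = trans (sym (coeff-fromHigh-top a t)) (trans (sym (coeff≡ (fromHigh-view g e) (length t))) (trans (cong (coeff g) eq) cg))


monomial-split : ∀ L N c → N ≤ L → monomial L c ≋ (xpow (L ∸ N) *ₚ xpow N) *ₚ const c
monomial-split L N c le =
  monomial≋xpow-* L c ⟨≋⟩ *-congˡ (const c) (≡⇒≋ (cong xpow (sym (ℕP.m∸n+n≡m le))) ⟨≋⟩ xpow-+ (L ∸ N) N)

subPre-correct : ∀ c gs r → length gs ≤ length r →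
  fromHigh (subPre c gs r) ≋ fromHigh r -ₚ const c *ₚ (xpow (length r ∸ length gs) *ₚ fromHigh gs)
  × length (subPre c gs r) ≡ length r
subPre-correct c [] r le = algebra (fromHigh r) (const c) (xpow (length r)) , refl
  where
  algebra : ∀ R C Y → R ≋ R -ₚ C *ₚ (Y *ₚ [])
  algebra = solve-∀ Poly-ring
subPre-correct c (g ∷ gs) (a ∷ r) (s≤s le) with subPre-correct c gs r le
... | ih , len =
  ( +-cong (≡⇒≋ (cong (λ n → monomial n (a ℤ.- c ℤ.* g)) len)
             ⟨≋⟩ monomial-split (length r) (length gs) (a ℤ.- c ℤ.* g) le
             ⟨≋⟩ *-congʳ (X *ₚ Y) (+-cong {const a} ≋-refl (neg-cong (const-* c g))))
           ih
    ⟨≋⟩ algebra X Y (const a) (const g) (const c) (fromHigh r) (fromHigh gs)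
    ⟨≋⟩ +-cong (+-cong (≋-sym (monomial-split (length r) (length gs) a le)) ≋-refl)
               (neg-cong (*-congʳ (const c) (*-congʳ X (+-cong (≋-sym (monomial≋xpow-* (length gs) g)) ≋-refl)))))
  , cong suc len
  where
  X = xpow (length r ∸ length gs)
  Y = xpow (length gs)
  algebra : ∀ X Y A G C R W → ((X *ₚ Y) *ₚ (A -ₚ C *ₚ G)) +ₚ (R -ₚ C *ₚ (X *ₚ W))
                              ≋ ((X *ₚ Y) *ₚ A +ₚ R) -ₚ C *ₚ (X *ₚ (Y *ₚ G +ₚ W))
  algebra = solve-∀ Poly-ring

DivLoopInvariant : List ℤ → List ℤ → List ℤ × List ℤ → Set
DivLoopInvariant gs l (qs , rs) =
  fromHigh l ≋ fromHigh qs *ₚ fromHigh (1ℤ ∷ gs) +ₚ fromHigh rs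
  × length rs ≤ length gs × length qs ≡ length l ∸ length gs

divLoop-step : ∀ gs n c rest → length gs ≤ length rest → length rest ≤ n →
  (∀ l → length l ≤ n → DivLoopInvariant gs l (divLoop n gs l)) →
  DivLoopInvariant gs (c ∷ rest) (c ∷ proj₁ (divLoop n gs (subPre c gs rest)) , proj₂ (divLoop n gs (subPre c gs rest)))
divLoop-step gs n c rest N≤L le rec with subPre-correct c gs rest N≤L
... | sub , sub-length with rec (subPre c gs rest) (subst (_≤ n) (sym sub-length) le)
...   | ih , rs-length , qs-length =
  ( +-cong (monomial-split L N c N≤L) (add-back (fromHigh rest) (const c *ₚ (X *ₚ W)) ⟨≋⟩ +-cong (≋-sym sub ⟨≋⟩ ih) ≋-refl)
    ⟨≋⟩ algebra X Y (const c) (fromHigh qs) (fromHigh rs) W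
    ⟨≋⟩ +-cong (*-congˡ (Y +ₚ W) (+-cong (≋-sym (monomial≋xpow-* (length qs) c ⟨≋⟩ *-congˡ (const c) (≡⇒≋ (cong xpow lq)))) ≋-refl)) ≋-refl )
  , rs-length , trans (cong suc lq) (sym (ℕP.+-∸-assoc 1 N≤L))
  where
  N = length gs
  L = length rest
  X = xpow (L ∸ N)
  Y = xpow N
  W = fromHigh gs
  qs = proj₁ (divLoop n gs (subPre c gs rest))
  rs = proj₂ (divLoop n gs (subPre c gs rest))
  lq : length qs ≡ L ∸ N
  lq = trans qs-length (cong (_∸ N) sub-length)
  add-back : ∀ R Z → R ≋ (R -ₚ Z) +ₚ Z
  add-back = solve-∀ Poly-ring
  algebra : ∀ X Y C Q S W → (X *ₚ Y) *ₚ C +ₚ ((Q *ₚ (Y +ₚ W) +ₚ S) +ₚ C *ₚ (X *ₚ W))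
                            ≋ (X *ₚ C +ₚ Q) *ₚ (Y +ₚ W) +ₚ S
  algebra = solve-∀ Poly-ring

divLoop-correct : ∀ gs fuel l → length l ≤ fuel → DivLoopInvariant gs l (divLoop fuel gs l)
divLoop-correct gs zero [] le = ≋-refl , z≤n , sym (ℕP.0∸n≡0 (length gs))
divLoop-correct gs (suc n) [] le = ≋-refl , z≤n , sym (ℕP.0∸n≡0 (length gs))
divLoop-correct gs (suc n) (c ∷ rest) (s≤s le) with length gs ≤ᵇ length rest in eq
... | false = ≋-refl , gt , sym (ℕP.m≤n⇒m∸n≡0 gt)
  where
  gt : length rest < length gs
  gt = ℕP.≰⇒> (λ nl → subst T eq (ℕP.≤⇒≤ᵇ {length gs} {length rest} nl))
... | true = divLoop-step gs n c rest (ℕP.≤ᵇ⇒≤ (length gs) (length rest) (subst T (sym eq) tt)) le (divLoop-correct gs n)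

quot-rem-correct : ∀ f g N → Monic g N → f ≋ quotₚ f g *ₚ g +ₚ remₚ f g × Deg< (remₚ f g) N
quot-rem-correct f g N mg with Monic-stripHigh g N mg
... | gs , e , len rewrite e =
  ( ≋fromHigh-reverse f ⟨≋⟩ proj₁ invariant
    ⟨≋⟩ +-cong (*-cong (≋-sym (reverse≋fromHigh qs)) (≋-sym (fromHigh-view g e))) (≋-sym (reverse≋fromHigh rs)) )
  , Deg<-mono (subst (_≤ N) (sym (ListP.length-reverse rs)) (subst (length rs ≤_) len (proj₁ (proj₂ invariant))))
              (Deg<-length (reverse rs))
  where
  invariant = divLoop-correct gs (length f) (reverse f) (ℕP.≤-reflexive (ListP.length-reverse f))
  qs = proj₁ (divLoop (length f) gs (reverse f))
  rs = proj₂ (divLoop (length f) gs (reverse f))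

quot-rem-unique : ∀ f g N Q R → Monic g N → f ≋ Q *ₚ g +ₚ R → Deg< R N → remₚ f g ≋ R × quotₚ f g ≋ Q
quot-rem-unique f g N Q R mg e dR with quot-rem-correct f g N mg
... | e′ , dr = r≋R , q≋Q
  where
  q = quotₚ f g
  r = remₚ f g
  difference : ∀ q r Q R g → R -ₚ r ≋ ((Q *ₚ g +ₚ R) -ₚ (q *ₚ g +ₚ r)) +ₚ (q -ₚ Q) *ₚ g
  difference = solve-∀ Poly-ring
  cancel : ∀ A B → (A -ₚ A) +ₚ B ≋ B
  cancel = solve-∀ Poly-ring
  R-r : R -ₚ r ≋ (q -ₚ Q) *ₚ g
  R-r = difference q r Q R g ⟨≋⟩ +-cong (+-cong {Q *ₚ g +ₚ R} ≋-refl (neg-cong (≋-sym e′ ⟨≋⟩ e))) ≋-refl ⟨≋⟩ cancel (Q *ₚ g +ₚ R) _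
  q-Q≋[] : q -ₚ Q ≋ []
  q-Q≋[] = *-monic-Deg<⇒≋[] (q -ₚ Q) mg (Deg<-resp R-r (Deg<-+ dR (Deg<-neg dr)))
  add-back : ∀ q Q → q ≋ (q -ₚ Q) +ₚ Q
  add-back = solve-∀ Poly-ring
  subtract-back : ∀ R r → r ≋ R -ₚ (R -ₚ r)
  subtract-back = solve-∀ Poly-ring
  -[]-identity : ∀ R → R -ₚ [] ≋ R
  -[]-identity = solve-∀ Poly-ring
  q≋Q : q ≋ Q
  q≋Q = add-back q Q ⟨≋⟩ +-cong q-Q≋[] ≋-refl
  r≋R : r ≋ R
  r≋R = subtract-back R r ⟨≋⟩ +-cong ≋-refl (neg-cong (R-r ⟨≋⟩ *-congˡ g q-Q≋[])) ⟨≋⟩ -[]-identity R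

-- Formal derivative, divisibility and coprimality

deriv : Poly → Poly
deriv [] = []
deriv (a ∷ f) = f +ₚ (0ℤ ∷ deriv f)

coeff-deriv : ∀ f k → coeff (deriv f) k ≡ + suc k ℤ.* coeff f (suc k)
coeff-deriv [] k = sym (ℤP.*-zeroʳ (+ suc k))
coeff-deriv (a ∷ f) zero = trans (coeff-+ f (0ℤ ∷ deriv f) zero) (trans (ℤP.+-identityʳ _) (sym (ℤP.*-identityˡ _)))
coeff-deriv (a ∷ f) (suc k) = begin
  coeff (f +ₚ (0ℤ ∷ deriv f)) (suc k)               ≡⟨ coeff-+ f (0ℤ ∷ deriv f) (suc k) ⟩
  coeff f (suc k) ℤ.+ coeff (deriv f) k             ≡⟨ cong (ℤ._+_ (coeff f (suc k))) (coeff-deriv f k) ⟩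
  coeff f (suc k) ℤ.+ + suc k ℤ.* coeff f (suc k)  ≡⟨ cong (ℤ._+ + suc k ℤ.* coeff f (suc k)) (ℤP.*-identityˡ (coeff f (suc k))) ⟨
  1ℤ ℤ.* coeff f (suc k) ℤ.+ + suc k ℤ.* coeff f (suc k) ≡⟨ ℤP.*-distribʳ-+ (coeff f (suc k)) 1ℤ (+ suc k) ⟨
  + suc (suc k) ℤ.* coeff f (suc k)                 ∎
  where open ≡-Reasoning

deriv-cong : ∀ {f g} → f ≋ g → deriv f ≋ deriv g
deriv-cong {f} {g} (coeffwise e) =
  coeffwise λ k → trans (coeff-deriv f k) (trans (cong (+ suc k ℤ.*_) (e (suc k))) (sym (coeff-deriv g k)))

deriv-+ : ∀ f g → deriv (f +ₚ g) ≋ deriv f +ₚ deriv g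
deriv-+ f g = coeffwise λ k →
  trans (coeff-deriv (f +ₚ g) k) (trans (cong (+ suc k ℤ.*_) (coeff-+ f g (suc k)))
    (trans (ℤP.*-distribˡ-+ (+ suc k) (coeff f (suc k)) (coeff g (suc k)))
      (sym (trans (coeff-+ (deriv f) (deriv g) k) (cong₂ ℤ._+_ (coeff-deriv f k) (coeff-deriv g k))))))

deriv-scale : ∀ a f → deriv (scaleₚ a f) ≋ scaleₚ a (deriv f)
deriv-scale a f = coeffwise λ k →
  trans (coeff-deriv (scaleₚ a f) k) (trans (cong (+ suc k ℤ.*_) (coeff-scale a f (suc k)))
    (trans (swap (+ suc k) a (coeff f (suc k))) (sym (trans (coeff-scale a (deriv f) k) (cong (a ℤ.*_) (coeff-deriv f k))))))
  where
  swap : ∀ x y z → x ℤ.* (y ℤ.* z) ≡ y ℤ.* (x ℤ.* z)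
  swap = ℤ-Solver.solve-∀

xₚ : Poly
xₚ = xpow 1

0∷≋xₚ* : ∀ f → 0ℤ ∷ f ≋ xₚ *ₚ f
0∷≋xₚ* f = ≋-sym (0∷-* oneₚ f ⟨≋⟩ ∷-cong refl (*-identityˡ f))

∷≋const+xₚ* : ∀ a f → a ∷ f ≋ const a +ₚ xₚ *ₚ f
∷≋const+xₚ* a f = ∷-cong (sym (ℤP.+-identityʳ a)) ≋-refl ⟨≋⟩ +-cong {const a} ≋-refl (0∷≋xₚ* f)

deriv-* : ∀ f g → deriv (f *ₚ g) ≋ deriv f *ₚ g +ₚ f *ₚ deriv g
deriv-* [] g = ≋-refl
deriv-* (a ∷ f) g =
  deriv-+ (scaleₚ a g) (0ℤ ∷ (f *ₚ g))
  ⟨≋⟩ +-cong (deriv-scale a g ⟨≋⟩ scale≋const-* a (deriv g))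
             (+-cong {f *ₚ g} ≋-refl (0∷≋xₚ* (deriv (f *ₚ g)) ⟨≋⟩ *-congʳ xₚ (deriv-* f g)))
  ⟨≋⟩ algebra (const a) xₚ f g (deriv g) (deriv f)
  ⟨≋⟩ +-cong (*-congˡ g (+-cong {f} ≋-refl (≋-sym (0∷≋xₚ* (deriv f))))) (*-congˡ (deriv g) (≋-sym (∷≋const+xₚ* a f)))
  where
  algebra : ∀ A X f g g′ f′ → A *ₚ g′ +ₚ (f *ₚ g +ₚ X *ₚ (f′ *ₚ g +ₚ f *ₚ g′))
                              ≋ (f +ₚ X *ₚ f′) *ₚ g +ₚ (A +ₚ X *ₚ f) *ₚ g′
  algebra = solve-∀ Poly-ring

xₚ*deriv-xpow : ∀ n → xₚ *ₚ deriv (xpow n) ≋ const (+ n) *ₚ xpow n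
xₚ*deriv-xpow n = ≋-sym (0∷≋xₚ* (deriv (xpow n))) ⟨≋⟩ coeffwise go ⟨≋⟩ scale≋const-* (+ n) (xpow n)
  where
  go : ∀ j → coeff (0ℤ ∷ deriv (xpow n)) j ≡ coeff (scaleₚ (+ n) (xpow n)) j
  go zero = sym (trans (coeff-scale (+ n) (xpow n) 0) (constant-term n))
    where
    constant-term : ∀ n → + n ℤ.* coeff (xpow n) 0 ≡ 0ℤ
    constant-term zero = refl
    constant-term (suc n) = ℤP.*-zeroʳ (+ suc n)
  go (suc k) = trans (coeff-deriv (xpow n) k) (sym (trans (coeff-scale (+ n) (xpow n) (suc k)) (same-factor (suc k ℕ.≟ n))))
    where
    same-factor : Dec (suc k ≡ n) → + n ℤ.* coeff (xpow n) (suc k) ≡ + suc k ℤ.* coeff (xpow n) (suc k)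
    same-factor (yes e) = cong (λ z → + z ℤ.* coeff (xpow n) (suc k)) (sym e)
    same-factor (no ne) =
      trans (cong (+ n ℤ.*_) (coeff-monomial-≢ n 1ℤ (suc k) ne))
        (trans (ℤP.*-zeroʳ (+ n)) (sym (trans (cong (+ suc k ℤ.*_) (coeff-monomial-≢ n 1ℤ (suc k) ne)) (ℤP.*-zeroʳ (+ suc k)))))

xₚ*deriv-xpow-1 : ∀ n → xₚ *ₚ deriv (xpow-1 n) ≋ const (+ n) *ₚ (xpow-1 n +ₚ oneₚ)
xₚ*deriv-xpow-1 n =
  *-congʳ xₚ (deriv-+ (xpow n) (negₚ oneₚ) ⟨≋⟩ +-cong {deriv (xpow n)} ≋-refl (coeffwise λ { zero → refl ; (suc k) → refl })
              ⟨≋⟩ +-identityʳ _)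
  ⟨≋⟩ xₚ*deriv-xpow n ⟨≋⟩ *-congʳ (const (+ n)) (add-back (xpow n) oneₚ)
  where
  add-back : ∀ a b → a ≋ (a -ₚ b) +ₚ b
  add-back = solve-∀ Poly-ring

infix 4 _∣ₚ_
_∣ₚ_ : Poly → Poly → Set
A ∣ₚ B = Σ Poly λ Q → B ≋ Q *ₚ A

-- Coprimality in ℚ[x], witnessed over ℤ by a Bézout identity U A + V B = c with c ≠ 0.
Coprimeₚ : Poly → Poly → Set
Coprimeₚ A B = Σ ℤ λ c → c ≢ 0ℤ × Σ Poly λ U → Σ Poly λ V → U *ₚ A +ₚ V *ₚ B ≋ const c

∣ₚ-refl : ∀ A → A ∣ₚ A
∣ₚ-refl A = oneₚ , ≋-sym (*-identityˡ A)

∣ₚ-trans : ∀ {A B D} → A ∣ₚ B → B ∣ₚ D → A ∣ₚ D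
∣ₚ-trans {A} (Q , e) (Q′ , e′) = Q′ *ₚ Q , (e′ ⟨≋⟩ *-congʳ Q′ e ⟨≋⟩ ≋-sym (*-assoc Q′ Q A))

∣ₚ-resp : ∀ {A A′ B B′} → A ≋ A′ → B ≋ B′ → A ∣ₚ B → A′ ∣ₚ B′
∣ₚ-resp ea eb (Q , e) = Q , (≋-sym eb ⟨≋⟩ e ⟨≋⟩ *-congʳ Q ea)

n∣ₚm*n : ∀ A K → A ∣ₚ K *ₚ A
n∣ₚm*n A K = K , ≋-refl

m∣ₚm*n : ∀ A K → A ∣ₚ A *ₚ K
m∣ₚm*n A K = K , *-comm A K

1∣ₚ : ∀ B → oneₚ ∣ₚ B
1∣ₚ B = B , ≋-sym (*-identityʳ B)

Coprimeₚ-sym : ∀ {A B} → Coprimeₚ A B → Coprimeₚ B A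
Coprimeₚ-sym {A} {B} (c , c≢0 , U , V , e) = c , c≢0 , V , U , (+-comm (V *ₚ B) (U *ₚ A) ⟨≋⟩ e)

Coprimeₚ-1 : ∀ A → Coprimeₚ A oneₚ
Coprimeₚ-1 A = 1ℤ , 1≢0 , [] , oneₚ , coeffwise λ { zero → refl ; (suc k) → refl }

Coprimeₚ-∣ˡ : ∀ {A A′ B} → A′ ∣ₚ A → Coprimeₚ A B → Coprimeₚ A′ B
Coprimeₚ-∣ˡ {A} {A′} {B} (K , eK) (c , c≢0 , U , V , e) =
  c , c≢0 , U *ₚ K , V , (+-cong (*-assoc U K A′ ⟨≋⟩ *-congʳ U (≋-sym eK)) (≋-refl {V *ₚ B}) ⟨≋⟩ e)

Coprimeₚ-∣ʳ : ∀ {A B B′} → B′ ∣ₚ B → Coprimeₚ A B → Coprimeₚ A B′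
Coprimeₚ-∣ʳ d cp = Coprimeₚ-sym (Coprimeₚ-∣ˡ d (Coprimeₚ-sym cp))

Coprimeₚ-* : ∀ {A B₁ B₂} → Coprimeₚ A B₁ → Coprimeₚ A B₂ → Coprimeₚ A (B₁ *ₚ B₂)
Coprimeₚ-* {A} {B₁} {B₂} (c₁ , c₁≢0 , U₁ , V₁ , e₁) (c₂ , c₂≢0 , U₂ , V₂ , e₂) =
  c₁ ℤ.* c₂ , c₁c₂≢0 , U₁ *ₚ U₂ *ₚ A +ₚ U₁ *ₚ V₂ *ₚ B₂ +ₚ V₁ *ₚ B₁ *ₚ U₂ , V₁ *ₚ V₂ ,
  (≋-sym (algebra U₁ V₁ U₂ V₂ A B₁ B₂) ⟨≋⟩ *-cong e₁ e₂ ⟨≋⟩ ≋-sym (const-* c₁ c₂))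
  where
  algebra : ∀ U₁ V₁ U₂ V₂ A B₁ B₂ →
    (U₁ *ₚ A +ₚ V₁ *ₚ B₁) *ₚ (U₂ *ₚ A +ₚ V₂ *ₚ B₂)
    ≋ (U₁ *ₚ U₂ *ₚ A +ₚ U₁ *ₚ V₂ *ₚ B₂ +ₚ V₁ *ₚ B₁ *ₚ U₂) *ₚ A +ₚ (V₁ *ₚ V₂) *ₚ (B₁ *ₚ B₂)
  algebra = solve-∀ Poly-ring
  c₁c₂≢0 : c₁ ℤ.* c₂ ≢ 0ℤ
  c₁c₂≢0 e with ℤP.i*j≡0⇒i≡0∨j≡0 c₁ e
  ... | inj₁ z = c₁≢0 z
  ... | inj₂ z = c₂≢0 z

-- x^d - 1 is squarefree: from Φ P = x^d - 1 and x (x^d - 1)′ = d x^d,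
-- (x P′ - d P) Φ + (x Φ′) P = d.
xpow-1-factors-coprime : ∀ d {A B} → 1 ≤ d → xpow-1 d ≋ A *ₚ B → Coprimeₚ A B
xpow-1-factors-coprime (suc d) {A} {B} _ e =
  + suc d , (λ ()) , xₚ *ₚ deriv B -ₚ const (+ suc d) *ₚ B , xₚ *ₚ deriv A ,
  ( expand xₚ (const (+ suc d)) A B (deriv A) (deriv B)
    ⟨≋⟩ +-cong (*-congʳ xₚ (≋-sym (deriv-* A B) ⟨≋⟩ deriv-cong (≋-sym e))) (neg-cong (*-congʳ (const (+ suc d)) (≋-sym e)))
    ⟨≋⟩ ≋-sym (solve-for-constant xₚ (const (+ suc d)) (xpow-1 (suc d)) (xₚ*deriv-xpow-1 (suc d))) )
  where
  expand : ∀ X C A B A′ B′ → (X *ₚ B′ -ₚ C *ₚ B) *ₚ A +ₚ (X *ₚ A′) *ₚ B ≋ X *ₚ (A′ *ₚ B +ₚ A *ₚ B′) -ₚ C *ₚ (A *ₚ B)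
  expand = solve-∀ Poly-ring
  solve-for-constant : ∀ X C F → X *ₚ deriv F ≋ C *ₚ (F +ₚ oneₚ) → C ≋ X *ₚ deriv F -ₚ C *ₚ F
  solve-for-constant X C F e′ = rearrange C F ⟨≋⟩ +-cong (≋-sym e′) (≋-refl {negₚ (C *ₚ F)})
    where
    rearrange : ∀ C F → C ≋ C *ₚ (F +ₚ oneₚ) -ₚ C *ₚ F
    rearrange = solve-∀ Poly-ring

Deg<-const-* : ∀ c {r k} → Deg< r k → Deg< (const c *ₚ r) k
Deg<-const-* c {r} dr = deg< λ j le → trans (coeff-const-* c r j) (trans (cong (c ℤ.*_) (vanish dr j le)) (ℤP.*-zeroʳ c))

const-*-≋[] : ∀ c {r} → c ≢ 0ℤ → const c *ₚ r ≋ [] → r ≋ []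
const-*-≋[] c {r} c≢0 e = coeffwise λ j → go j (trans (sym (coeff-const-* c r j)) (coeff≡ e j))
  where
  go : ∀ j → c ℤ.* coeff r j ≡ 0ℤ → coeff r j ≡ 0ℤ
  go j z with ℤP.i*j≡0⇒i≡0∨j≡0 c z
  ... | inj₁ c≡0 = ⊥-elim (c≢0 c≡0)
  ... | inj₂ r≡0 = r≡0

-- With U A + V B = c, F = Q₁ A = Q₂ B gives c F = (U Q₂ + V Q₁) A B; dividing F by the
-- monic A B then leaves a remainder r with c r a multiple of A B of smaller degree, so r = 0.
*-∣ₚ-coprime : ∀ {A B F k} → Monic (A *ₚ B) k → A ∣ₚ F → B ∣ₚ F → Coprimeₚ A B → A *ₚ B ∣ₚ F
*-∣ₚ-coprime {A} {B} {F} {k} mAB (Q₁ , e₁) (Q₂ , e₂) (c , c≢0 , U , V , e) =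
  q , (F≋ ⟨≋⟩ +-cong {q *ₚ AB} ≋-refl r≋[] ⟨≋⟩ +-identityʳ _)
  where
  AB = A *ₚ B
  W = U *ₚ Q₂ +ₚ V *ₚ Q₁
  q = quotₚ F AB
  r = remₚ F AB
  F≋ : F ≋ q *ₚ AB +ₚ r
  F≋ = proj₁ (quot-rem-correct F AB k mAB)
  distribute : ∀ U A V B F → (U *ₚ A +ₚ V *ₚ B) *ₚ F ≋ U *ₚ A *ₚ F +ₚ V *ₚ B *ₚ F
  distribute = solve-∀ Poly-ring
  collect : ∀ U A V B Q₁ Q₂ → U *ₚ A *ₚ (Q₂ *ₚ B) +ₚ V *ₚ B *ₚ (Q₁ *ₚ A) ≋ (U *ₚ Q₂ +ₚ V *ₚ Q₁) *ₚ (A *ₚ B)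
  collect = solve-∀ Poly-ring
  isolate : ∀ C q AB r W → C *ₚ r ≋ (C *ₚ (q *ₚ AB +ₚ r) -ₚ W *ₚ AB) +ₚ (W -ₚ C *ₚ q) *ₚ AB
  isolate = solve-∀ Poly-ring
  cF : const c *ₚ F ≋ W *ₚ AB
  cF = *-congˡ F (≋-sym e) ⟨≋⟩ distribute U A V B F
       ⟨≋⟩ +-cong (*-congʳ (U *ₚ A) e₂) (*-congʳ (V *ₚ B) e₁) ⟨≋⟩ collect U A V B Q₁ Q₂
  cr : const c *ₚ r ≋ (W -ₚ const c *ₚ q) *ₚ AB
  cr = isolate (const c) q AB r W
       ⟨≋⟩ +-cong (+-cong (*-congʳ (const c) (≋-sym F≋) ⟨≋⟩ cF) (≋-refl {negₚ (W *ₚ AB)}) ⟨≋⟩ -‿inverseʳ (W *ₚ AB)) ≋-refl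
  W-cq≋[] : W -ₚ const c *ₚ q ≋ []
  W-cq≋[] = *-monic-Deg<⇒≋[] (W -ₚ const c *ₚ q) mAB (Deg<-resp cr (Deg<-const-* c (proj₂ (quot-rem-correct F AB k mAB))))
  r≋[] : r ≋ []
  r≋[] = const-*-≋[] c c≢0 (cr ⟨≋⟩ *-congˡ AB W-cq≋[])

xpow-1-∣ₚ-xpow-1-* : ∀ a k → xpow-1 a ∣ₚ xpow-1 (k ℕ.* a)
xpow-1-∣ₚ-xpow-1-* a zero = [] , coeffwise λ { zero → refl ; (suc k) → refl }
xpow-1-∣ₚ-xpow-1-* a (suc k) with xpow-1-∣ₚ-xpow-1-* a k
... | Q , e = xpow a *ₚ Q +ₚ oneₚ ,
  ( +-cong (xpow-+ a (k ℕ.* a)) (≋-refl {negₚ oneₚ}) ⟨≋⟩ telescope (xpow a) (xpow (k ℕ.* a))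
    ⟨≋⟩ +-cong (*-congʳ (xpow a) e) (≋-refl {xpow-1 a}) ⟨≋⟩ collect (xpow a) Q (xpow-1 a) )
  where
  telescope : ∀ Y Z → Y *ₚ Z -ₚ oneₚ ≋ Y *ₚ (Z -ₚ oneₚ) +ₚ (Y -ₚ oneₚ)
  telescope = solve-∀ Poly-ring
  collect : ∀ Y Q A → Y *ₚ (Q *ₚ A) +ₚ A ≋ (Y *ₚ Q +ₚ oneₚ) *ₚ A
  collect = solve-∀ Poly-ring

xpow-1-∣ₚ : ∀ {a n} → a ∣ n → xpow-1 a ∣ₚ xpow-1 n
xpow-1-∣ₚ {a} (divides k refl) = xpow-1-∣ₚ-xpow-1-* a k

bezout-step : ∀ G Z Qa Qb A B → G *ₚ Z -ₚ oneₚ ≋ Qa *ₚ A → Z -ₚ oneₚ ≋ Qb *ₚ B →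
  Qa *ₚ A +ₚ negₚ (G *ₚ Qb) *ₚ B ≋ G -ₚ oneₚ
bezout-step G Z Qa Qb A B e₁ e₂ =
  +-cong (≋-sym e₁) (pull-neg G Qb B ⟨≋⟩ neg-cong (*-congʳ G (≋-sym e₂))) ⟨≋⟩ telescope G Z
  where
  pull-neg : ∀ G Q B → negₚ (G *ₚ Q) *ₚ B ≋ negₚ (G *ₚ (Q *ₚ B))
  pull-neg = solve-∀ Poly-ring
  telescope : ∀ G Z → (G *ₚ Z -ₚ oneₚ) +ₚ negₚ (G *ₚ (Z -ₚ oneₚ)) ≋ G -ₚ oneₚ
  telescope = solve-∀ Poly-ring

-- From a Bézout identity u a = g + v b of exponents: (x^(u a) - 1) - x^g (x^(v b) - 1) = x^g - 1.
xpow-1-bezout : ∀ a b → Σ Poly λ U → Σ Poly λ V → U *ₚ xpow-1 a +ₚ V *ₚ xpow-1 b ≋ xpow-1 (gcd a b)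
xpow-1-bezout a b with Bézout.identity (gcd-GCD a b)
... | Bézout.+- x y eq with xpow-1-∣ₚ-xpow-1-* a x | xpow-1-∣ₚ-xpow-1-* b y
...   | Qa , ea | Qb , eb = Qa , negₚ (xpow g *ₚ Qb) ,
        bezout-step (xpow g) (xpow (y ℕ.* b)) Qa Qb (xpow-1 a) (xpow-1 b)
          (+-cong (≋-sym (xpow-+ g (y ℕ.* b)) ⟨≋⟩ ≡⇒≋ (cong xpow eq)) (≋-refl {negₚ oneₚ}) ⟨≋⟩ ea) eb
  where g = gcd a b
xpow-1-bezout a b | Bézout.-+ x y eq with xpow-1-∣ₚ-xpow-1-* a x | xpow-1-∣ₚ-xpow-1-* b y
...   | Qa , ea | Qb , eb = negₚ (xpow g *ₚ Qa) , Qb ,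
        ( +-comm (negₚ (xpow g *ₚ Qa) *ₚ xpow-1 a) (Qb *ₚ xpow-1 b)
          ⟨≋⟩ bezout-step (xpow g) (xpow (x ℕ.* a)) Qb Qa (xpow-1 b) (xpow-1 a)
                (+-cong (≋-sym (xpow-+ g (x ℕ.* a)) ⟨≋⟩ ≡⇒≋ (cong xpow eq)) (≋-refl {negₚ oneₚ}) ⟨≋⟩ eb) ea )
  where g = gcd a b

-- Products over divisors

factorIf : (ℕ → Bool) → (ℕ → Poly) → ℕ → Poly
factorIf c f d = if c d then f d else oneₚ

∏ : (ℕ → Bool) → (ℕ → Poly) → ℕ → Poly
∏ c f zero = oneₚ
∏ c f (suc N) = ∏ c f N *ₚ factorIf c f N

mulIf : (ℕ → Bool) → (ℕ → Poly) → ℕ → Poly → Poly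
mulIf c f d acc = if c d then f d *ₚ acc else acc

foldr-mulIf-init : ∀ c f ds e → foldr (mulIf c f) e ds ≋ foldr (mulIf c f) oneₚ ds *ₚ e
foldr-mulIf-init c f [] e = ≋-sym (*-identityˡ e)
foldr-mulIf-init c f (d ∷ ds) e with c d
... | true = *-congʳ (f d) (foldr-mulIf-init c f ds e) ⟨≋⟩ ≋-sym (*-assoc (f d) _ e)
... | false = foldr-mulIf-init c f ds e

mulIf-oneₚ : ∀ c f d → mulIf c f d oneₚ ≋ factorIf c f d
mulIf-oneₚ c f d with c d
... | true = *-identityʳ (f d)
... | false = ≋-refl

foldr-mulIf≋∏ : ∀ c f N → foldr (mulIf c f) oneₚ (upTo N) ≋ ∏ c f N
foldr-mulIf≋∏ c f zero = ≋-refl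
foldr-mulIf≋∏ c f (suc N) =
  ≡⇒≋ (trans (cong (foldr (mulIf c f) oneₚ) (sym (ListP.upTo-∷ʳ N))) (ListP.foldr-++ (mulIf c f) oneₚ (upTo N) [ N ]))
  ⟨≋⟩ foldr-mulIf-init c f (upTo N) (mulIf c f N oneₚ) ⟨≋⟩ *-cong (foldr-mulIf≋∏ c f N) (mulIf-oneₚ c f N)

∏-cong : ∀ {c c′ f g} N → (∀ d → d < N → factorIf c f d ≋ factorIf c′ g d) → ∏ c f N ≋ ∏ c′ g N
∏-cong zero h = ≋-refl
∏-cong (suc N) h = *-cong (∏-cong N (λ d lt → h d (ℕP.m<n⇒m<1+n lt))) (h N ℕP.≤-refl)

factorIf-cong : ∀ c f g d → (c d ≡ true → f d ≋ g d) → factorIf c f d ≋ factorIf c g d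
factorIf-cong c f g d h with c d
... | true = h refl
... | false = ≋-refl

factorIf-condition : ∀ {c c′ : ℕ → Bool} (f : ℕ → Poly) d → c d ≡ c′ d → factorIf c f d ≋ factorIf c′ f d
factorIf-condition f d e = ≡⇒≋ (cong (λ b → if b then f d else oneₚ) e)

∏-Monic : ∀ c f N → (∀ d → d < N → c d ≡ true → Σ ℕ (Monic (f d))) → Σ ℕ (Monic (∏ c f N))
∏-Monic c f zero h = 0 , Monic-oneₚ
∏-Monic c f (suc N) h with ∏-Monic c f N (λ d lt → h d (ℕP.m<n⇒m<1+n lt)) | c N in eq
... | E , mE | true with h N ℕP.≤-refl eq
...   | D , mD = E ℕ.+ D , Monic-* mE mD
∏-Monic c f (suc N) h | E , mE | false = E ℕ.+ 0 , Monic-* mE Monic-oneₚ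

Coprimeₚ-∏ : ∀ {A} c f N → (∀ d → d < N → c d ≡ true → Coprimeₚ A (f d)) → Coprimeₚ A (∏ c f N)
Coprimeₚ-∏ {A} c f zero h = Coprimeₚ-1 A
Coprimeₚ-∏ {A} c f (suc N) h = Coprimeₚ-* (Coprimeₚ-∏ c f N (λ d lt → h d (ℕP.m<n⇒m<1+n lt))) last
  where
  last : Coprimeₚ A (factorIf c f N)
  last with c N in eq
  ... | true = h N ℕP.≤-refl eq
  ... | false = Coprimeₚ-1 A

factor∣ₚ∏ : ∀ c f N d → d < N → c d ≡ true → f d ∣ₚ ∏ c f N
factor∣ₚ∏ c f (suc N) d lt cd with ℕP.m≤n⇒m<n∨m≡n lt
... | inj₁ lt′ = ∣ₚ-trans (factor∣ₚ∏ c f N d (ℕP.≤-pred lt′) cd) (m∣ₚm*n (∏ c f N) (factorIf c f N))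
... | inj₂ refl = ∣ₚ-resp ≋-refl (*-congʳ (∏ c f N) (≡⇒≋ (sym (cong (λ b → if b then f d else oneₚ) cd)))) (n∣ₚm*n (f d) (∏ c f N))

∏-none : ∀ (c : ℕ → Bool) (f : ℕ → Poly) N → (∀ d → d < N → c d ≡ false) → ∏ c f N ≋ oneₚ
∏-none c f zero h = ≋-refl
∏-none c f (suc N) h with c N in eq
... | true with () ← trans (sym eq) (h N ℕP.≤-refl)
... | false = *-identityʳ _ ⟨≋⟩ ∏-none c f N (λ d lt → h d (ℕP.m<n⇒m<1+n lt))

∏-+ : ∀ c f N k → ∏ c f (N ℕ.+ k) ≋ ∏ c f N *ₚ ∏ (λ d → c (N ℕ.+ d)) (λ d → f (N ℕ.+ d)) k
∏-+ c f N zero = ≡⇒≋ (cong (∏ c f) (ℕP.+-identityʳ N)) ⟨≋⟩ ≋-sym (*-identityʳ _)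
∏-+ c f N (suc k) =
  ≡⇒≋ (cong (∏ c f) (ℕP.+-suc N k)) ⟨≋⟩ *-congˡ (factorIf c f (N ℕ.+ k)) (∏-+ c f N k) ⟨≋⟩ *-assoc (∏ c f N) _ _

∏-multiples : ∀ p c f → 1 ≤ p → (∀ d → ¬ p ∣ d → c d ≡ false) → ∀ K →
  ∏ c f (p ℕ.* K) ≋ ∏ (λ e → c (p ℕ.* e)) (λ e → f (p ℕ.* e)) K
∏-multiples p c f 1≤p h zero = ≡⇒≋ (cong (∏ c f) (ℕP.*-zeroʳ p))
∏-multiples (suc p′) c f 1≤p h (suc K) =
  ≡⇒≋ (cong (∏ c f) (trans (ℕP.*-suc p K) (ℕP.+-comm p (p ℕ.* K))))
  ⟨≋⟩ ∏-+ c f (p ℕ.* K) p ⟨≋⟩ *-cong (∏-multiples p c f 1≤p h K) block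
  where
  p = suc p′
  c′ = λ d → c (p ℕ.* K ℕ.+ d)
  f′ = λ d → f (p ℕ.* K ℕ.+ d)
  non-multiple : ∀ d → d < p′ → ¬ p ∣ (p ℕ.* K ℕ.+ suc d)
  non-multiple d lt dv = ℕP.<⇒≱ (s≤s lt) (∣⇒≤ (∣m+n∣m⇒∣n dv (m∣m*n K)))
  block : ∏ c′ f′ p ≋ factorIf c f (p ℕ.* K)
  block = ∏-+ c′ f′ 1 p′
          ⟨≋⟩ *-cong (*-identityˡ (factorIf c′ f′ 0) ⟨≋⟩ ≡⇒≋ (cong (factorIf c f) (ℕP.+-identityʳ (p ℕ.* K))))
                     (∏-none _ _ p′ (λ d lt → h (p ℕ.* K ℕ.+ suc d) (non-multiple d lt)))
          ⟨≋⟩ *-identityʳ _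

∏-split : ∀ (c q : ℕ → Bool) (f : ℕ → Poly) N → ∏ c f N ≋ ∏ (λ d → c d ∧ q d) f N *ₚ ∏ (λ d → c d ∧ not (q d)) f N
∏-split c q f zero = ≋-sym (*-identityˡ oneₚ)
∏-split c q f (suc N) =
  *-cong (∏-split c q f N) (split N)
  ⟨≋⟩ interchange (∏ (λ d → c d ∧ q d) f N) (∏ (λ d → c d ∧ not (q d)) f N)
                  (factorIf (λ d → c d ∧ q d) f N) (factorIf (λ d → c d ∧ not (q d)) f N)
  where
  split : ∀ d → factorIf c f d ≋ factorIf (λ d → c d ∧ q d) f d *ₚ factorIf (λ d → c d ∧ not (q d)) f d
  split d with c d | q d
  ... | true | true = ≋-sym (*-identityʳ (f d))
  ... | true | false = ≋-sym (*-identityˡ (f d))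
  ... | false | _ = ≋-sym (*-identityˡ oneₚ)
  interchange : ∀ A B C D → (A *ₚ B) *ₚ (C *ₚ D) ≋ (A *ₚ C) *ₚ (B *ₚ D)
  interchange = solve-∀ Poly-ring

∏-* : ∀ (c : ℕ → Bool) (f g : ℕ → Poly) N → ∏ c (λ d → f d *ₚ g d) N ≋ ∏ c f N *ₚ ∏ c g N
∏-* c f g zero = ≋-sym (*-identityˡ oneₚ)
∏-* c f g (suc N) = *-cong (∏-* c f g N) (split N) ⟨≋⟩ interchange (∏ c f N) (∏ c g N) (factorIf c f N) (factorIf c g N)
  where
  split : ∀ d → factorIf c (λ d → f d *ₚ g d) d ≋ factorIf c f d *ₚ factorIf c g d
  split d with c d
  ... | true = ≋-refl
  ... | false = ≋-sym (*-identityˡ oneₚ)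
  interchange : ∀ A B C D → (A *ₚ B) *ₚ (C *ₚ D) ≋ (A *ₚ C) *ₚ (B *ₚ D)
  interchange = solve-∀ Poly-ring

-- The table of cyclotomic polynomials

isDivisor : ℕ → ℕ → Bool
isDivisor n d = (1 ≤ᵇ d) ∧ ⌊ d ∣? n ⌋

isDivisor-true : ∀ {n d} → 1 ≤ d → d ∣ n → isDivisor n d ≡ true
isDivisor-true {n} {suc d} _ d∣n with suc d ∣? n
... | yes _ = refl
... | no d∤n = ⊥-elim (d∤n d∣n)

isDivisor-sound : ∀ {n d} → isDivisor n d ≡ true → 1 ≤ d × d ∣ n
isDivisor-sound {n} {suc d} e with suc d ∣? n
... | yes d∣n = s≤s z≤n , d∣n

isDivisor-false : ∀ {n d} → ¬ d ∣ n → isDivisor n d ≡ false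
isDivisor-false {n} {zero} _ = refl
isDivisor-false {n} {suc d} d∤n with suc d ∣? n
... | yes d∣n = ⊥-elim (d∤n d∣n)
... | no _ = refl

isDivisor-> : ∀ {n d} → 1 ≤ n → n < d → isDivisor n d ≡ false
isDivisor-> {suc n} _ lt = isDivisor-false (λ dv → ℕP.<⇒≱ lt (∣⇒≤ dv))

factorIf-isDivisor-self : ∀ n → 1 ≤ n → (g : ℕ → Poly) → factorIf (isDivisor n) g n ≋ g n
factorIf-isDivisor-self n 1≤n g = ≡⇒≋ (cong (λ b → if b then g n else oneₚ) (isDivisor-true 1≤n ∣-refl))

length-cycloTable : ∀ n → length (cycloTable n) ≡ n
length-cycloTable zero = refl
length-cycloTable (suc n) = trans (ListP.length-++ (cycloTable n)) (trans (cong (ℕ._+ 1) (length-cycloTable n)) (ℕP.+-comm n 1))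

at-++ˡ : ∀ fs gs k → k < length fs → at (fs ++ gs) k ≡ at fs k
at-++ˡ (f ∷ fs) gs zero lt = refl
at-++ˡ (f ∷ fs) gs (suc k) (s≤s lt) = at-++ˡ fs gs k lt

at-++-last : ∀ fs g → at (fs ++ [ g ]) (length fs) ≡ g
at-++-last [] g = refl
at-++-last (f ∷ fs) g = at-++-last fs g

Φ-suc : ∀ n → Φ (suc n) ≡ quotₚ (xpow-1 (suc n)) (properDivProd (cycloTable n) (suc n))
Φ-suc n = subst (λ k → at (cycloTable n ++ [ new ]) k ≡ new) (length-cycloTable n) (at-++-last (cycloTable n) new)
  where new = quotₚ (xpow-1 (suc n)) (properDivProd (cycloTable n) (suc n))

at-cycloTable : ∀ n d → 1 ≤ d → d ≤ n → at (cycloTable n) (d ∸ 1) ≡ Φ d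
at-cycloTable (suc n) (suc d) _ le with ℕP.m≤n⇒m<n∨m≡n le
... | inj₂ refl = refl
... | inj₁ (s≤s lt) =
  trans (at-++ˡ (cycloTable n) _ d (subst (d <_) (sym (length-cycloTable n)) lt)) (at-cycloTable n (suc d) (s≤s z≤n) lt)

properDivisorProduct : ℕ → Poly
properDivisorProduct n = ∏ (isDivisor n) Φ n

divisorProduct : ℕ → Poly
divisorProduct n = ∏ (isDivisor n) Φ (suc n)

properDivProd≋ : ∀ n → properDivProd (cycloTable n) (suc n) ≋ properDivisorProduct (suc n)
properDivProd≋ n =
  foldr-mulIf≋∏ (isDivisor (suc n)) (λ d → at (cycloTable n) (d ∸ 1)) (suc n)
  ⟨≋⟩ ∏-cong (suc n) (λ d lt → factorIf-cong (isDivisor (suc n)) (λ d → at (cycloTable n) (d ∸ 1)) Φ d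
                          (λ e → ≡⇒≋ (at-cycloTable n d (proj₁ (isDivisor-sound e)) (ℕP.≤-pred lt))))

divisorProduct≋ : ∀ n → 1 ≤ n → divisorProduct n ≋ properDivisorProduct n *ₚ Φ n
divisorProduct≋ n 1≤n = *-congʳ (properDivisorProduct n) (factorIf-isDivisor-self n 1≤n Φ)

-- The factorisation of x^n - 1

record Factorisation (n : ℕ) : Set where
  field
    degree : ℕ
    Φ-monic : Monic (Φ n) degree
    proper-degree : ℕ
    proper-monic : Monic (properDivisorProduct n) proper-degree
    xpow-1≋ : xpow-1 n ≋ Φ n *ₚ properDivisorProduct n

  xpow-1≋divisorProduct : 1 ≤ n → xpow-1 n ≋ divisorProduct n
  xpow-1≋divisorProduct 1≤n = xpow-1≋ ⟨≋⟩ *-comm (Φ n) (properDivisorProduct n) ⟨≋⟩ ≋-sym (divisorProduct≋ n 1≤n)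

gcd≥1 : ∀ {g a} → 1 ≤ a → g ∣ a → 1 ≤ g
gcd≥1 {zero} {suc a} _ g∣a with () ← 0∣⇒≡0 g∣a
gcd≥1 {suc g} _ _ = s≤s z≤n

∣⇒≤′ : ∀ {m a} → 1 ≤ a → m ∣ a → m ≤ a
∣⇒≤′ {a = suc a} _ m∣a = ∣⇒≤ m∣a

Coprimeₚ-via-gcd : ∀ {A B P Q Ya Yb Yg U V} → Coprimeₚ A Yg → U *ₚ Ya +ₚ V *ₚ Yb ≋ Yg →
  Ya ≋ A *ₚ P → Yb ≋ B *ₚ Q → Coprimeₚ A B
Coprimeₚ-via-gcd {A} {B} {P} {Q} {Ya} {Yb} {Yg} {U} {V} (c , c≢0 , U₁ , V₁ , e₁) eg ea eb =
  c , c≢0 , U₁ +ₚ V₁ *ₚ U *ₚ P , V₁ *ₚ V *ₚ Q ,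
  ( ≋-sym (algebra U₁ V₁ U V A P B Q)
    ⟨≋⟩ +-cong (≋-refl {U₁ *ₚ A}) (*-congʳ V₁ (≋-sym (+-cong (*-congʳ U ea) (*-congʳ V eb)) ⟨≋⟩ eg))
    ⟨≋⟩ e₁ )
  where
  algebra : ∀ U₁ V₁ U V A P B Q → U₁ *ₚ A +ₚ V₁ *ₚ (U *ₚ (A *ₚ P) +ₚ V *ₚ (B *ₚ Q))
                                  ≋ (U₁ +ₚ V₁ *ₚ U *ₚ P) *ₚ A +ₚ (V₁ *ₚ V *ₚ Q) *ₚ B
  algebra = solve-∀ Poly-ring

module FactorisationStep (n : ℕ) (IH : ∀ d → d < n → 1 ≤ d → Factorisation d) where

  open Factorisation

  Φ-monic< : ∀ d → d < n → 1 ≤ d → Σ ℕ (Monic (Φ d))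
  Φ-monic< d d<n 1≤d = degree (IH d d<n 1≤d) , Φ-monic (IH d d<n 1≤d)

  Coprimeₚ-proper-divisor : ∀ a e → a < n → 1 ≤ e → e < a → e ∣ a → Coprimeₚ (Φ a) (Φ e)
  Coprimeₚ-proper-divisor a e a<n 1≤e e<a e∣a =
    Coprimeₚ-∣ʳ (factor∣ₚ∏ (isDivisor a) Φ a e e<a (isDivisor-true 1≤e e∣a))
      (xpow-1-factors-coprime a 1≤a (xpow-1≋ (IH a a<n 1≤a)))
    where
    1≤a : 1 ≤ a
    1≤a = ℕP.≤-trans 1≤e (ℕP.<⇒≤ e<a)

  Coprimeₚ-xpow-1-proper-divisor : ∀ a g → a < n → 1 ≤ g → g < a → g ∣ a → Coprimeₚ (Φ a) (xpow-1 g)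
  Coprimeₚ-xpow-1-proper-divisor a g a<n 1≤g g<a g∣a =
    Coprimeₚ-∣ʳ (∣ₚ-resp ≋-refl (xpow-1≋divisorProduct (IH g (ℕP.<-trans g<a a<n) 1≤g) 1≤g) (∣ₚ-refl _))
      (Coprimeₚ-∏ (isDivisor g) Φ (suc g) λ e e≤g e∣g →
        Coprimeₚ-proper-divisor a e a<n (proj₁ (isDivisor-sound e∣g)) (ℕP.≤-<-trans (ℕP.≤-pred e≤g) g<a)
          (∣-trans (proj₂ (isDivisor-sound e∣g)) g∣a))

  Coprimeₚ-gcd< : ∀ a b → a < n → b < n → 1 ≤ a → 1 ≤ b → gcd a b < a → Coprimeₚ (Φ a) (Φ b)
  Coprimeₚ-gcd< a b a<n b<n 1≤a 1≤b g<a with xpow-1-bezout a b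
  ... | U , V , bezout =
    Coprimeₚ-via-gcd {U = U} {V = V}
      (Coprimeₚ-xpow-1-proper-divisor a (gcd a b) a<n (gcd≥1 1≤a (gcd[m,n]∣m a b)) g<a (gcd[m,n]∣m a b))
      bezout (xpow-1≋ (IH a a<n 1≤a)) (xpow-1≋ (IH b b<n 1≤b))

  Coprimeₚ-distinct : ∀ a b → a < n → b < n → 1 ≤ a → 1 ≤ b → a ≢ b → Coprimeₚ (Φ a) (Φ b)
  Coprimeₚ-distinct a b a<n b<n 1≤a 1≤b a≢b with ℕP.m≤n⇒m<n∨m≡n (∣⇒≤′ 1≤a (gcd[m,n]∣m a b))
  ... | inj₁ lt = Coprimeₚ-gcd< a b a<n b<n 1≤a 1≤b lt
  ... | inj₂ gcd≡a = Coprimeₚ-sym (Coprimeₚ-gcd< b a b<n a<n 1≤b 1≤a gcd<b)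
    where
    gcd<b : gcd b a < b
    gcd<b with ℕP.m≤n⇒m<n∨m≡n (∣⇒≤′ 1≤b (gcd[m,n]∣m b a))
    ... | inj₁ lt = lt
    ... | inj₂ e = ⊥-elim (a≢b (trans (sym gcd≡a) (trans (gcd-comm a b) e)))

  -- Multiply in the divisors d < N of n one at a time; each new Φ d divides x^d - 1 ∣ x^n - 1
  -- and is coprime to the product so far.
  ∏-∣ₚ-xpow-1 : ∀ N → N ≤ n → ∏ (isDivisor n) Φ N ∣ₚ xpow-1 n
  ∏-∣ₚ-xpow-1 zero _ = 1∣ₚ (xpow-1 n)
  ∏-∣ₚ-xpow-1 (suc N) N<n with isDivisor n N in eq
  ... | false = ∣ₚ-resp (≋-sym (*-identityʳ _)) ≋-refl (∏-∣ₚ-xpow-1 N (ℕP.<⇒≤ N<n))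
  ... | true =
    *-∣ₚ-coprime (Monic-* (proj₂ monic-so-far) (proj₂ (Φ-monic< N N<n 1≤N)))
      (∏-∣ₚ-xpow-1 N (ℕP.<⇒≤ N<n))
      (∣ₚ-trans (∣ₚ-resp ≋-refl (≋-sym (xpow-1≋ (IH N N<n 1≤N))) (m∣ₚm*n (Φ N) (properDivisorProduct N))) (xpow-1-∣ₚ N∣n))
      (Coprimeₚ-sym (Coprimeₚ-∏ (isDivisor n) Φ N λ e e<N e∣n →
        Coprimeₚ-distinct N e N<n (ℕP.<-trans e<N N<n) 1≤N (proj₁ (isDivisor-sound e∣n)) (λ N≡e → ℕP.<⇒≢ e<N (sym N≡e))))
    where
    1≤N = proj₁ (isDivisor-sound eq)
    N∣n = proj₂ (isDivisor-sound eq)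
    monic-so-far = ∏-Monic (isDivisor n) Φ N (λ d d<N d∣n → Φ-monic< d (ℕP.<-trans d<N N<n) (proj₁ (isDivisor-sound d∣n)))

  proper-Monic : Σ ℕ (Monic (properDivisorProduct n))
  proper-Monic = ∏-Monic (isDivisor n) Φ n (λ d d<n d∣n → Φ-monic< d d<n (proj₁ (isDivisor-sound d∣n)))

-- Φ n is computed as the quotient of x^n - 1 by the product P of the Φ d for proper divisors d;
-- the division is exact because P divides x^n - 1.
factorisation : ∀ n → 1 ≤ n → Factorisation n
factorisation = <-rec (λ n → 1 ≤ n → Factorisation n) step
  where
  step : ∀ n → (∀ {d} → d < n → 1 ≤ d → Factorisation d) → 1 ≤ n → Factorisation n
  step (suc n) rec 1≤n with FactorisationStep.proper-Monic (suc n) (λ d → rec) | FactorisationStep.∏-∣ₚ-xpow-1 (suc n) (λ d → rec) (suc n) ℕP.≤-refl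
  ... | E , mP | Q , eQ = record
    { degree = suc n ∸ E ; Φ-monic = proj₁ Φ-cofactor
    ; proper-degree = E ; proper-monic = mP
    ; xpow-1≋ = xpow-1≋ }
    where
    P = properDivProd (cycloTable n) (suc n)
    Φ≋Q : Φ (suc n) ≋ Q
    Φ≋Q = ≡⇒≋ (Φ-suc n)
          ⟨≋⟩ proj₂ (quot-rem-unique (xpow-1 (suc n)) P E Q [] (Monic-resp (≋-sym (properDivProd≋ n)) mP)
                       (eQ ⟨≋⟩ *-congʳ Q (≋-sym (properDivProd≋ n)) ⟨≋⟩ ≋-sym (+-identityʳ _)) (deg< λ _ _ → refl))
    xpow-1≋ : xpow-1 (suc n) ≋ Φ (suc n) *ₚ properDivisorProduct (suc n)
    xpow-1≋ = eQ ⟨≋⟩ *-congˡ (properDivisorProduct (suc n)) (≋-sym Φ≋Q)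
    Φ-cofactor = Monic-cofactor (Φ (suc n)) (Monic-xpow-1 (suc n) (s≤s z≤n)) xpow-1≋ mP

-- Substituting x^p for x

substPow : ℕ → Poly → Poly
substPow p [] = []
substPow p (a ∷ f) = const a +ₚ xpow p *ₚ substPow p f

substPow-+ : ∀ p f g → substPow p (f +ₚ g) ≋ substPow p f +ₚ substPow p g
substPow-+ p [] g = ≋-refl
substPow-+ p (a ∷ f) [] = ≋-sym (+-identityʳ _)
substPow-+ p (a ∷ f) (b ∷ g) =
  +-cong ≋-refl (*-congʳ (xpow p) (substPow-+ p f g)) ⟨≋⟩ algebra (const a) (const b) (xpow p) (substPow p f) (substPow p g)
  where
  algebra : ∀ A B X F G → (A +ₚ B) +ₚ X *ₚ (F +ₚ G) ≋ (A +ₚ X *ₚ F) +ₚ (B +ₚ X *ₚ G)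
  algebra = solve-∀ Poly-ring

substPow-scale : ∀ p a g → substPow p (scaleₚ a g) ≋ const a *ₚ substPow p g
substPow-scale p a [] = ≋-sym (*-zeroʳ (const a))
substPow-scale p a (b ∷ g) =
  +-cong (const-* a b) (*-congʳ (xpow p) (substPow-scale p a g)) ⟨≋⟩ algebra (const a) (const b) (xpow p) (substPow p g)
  where
  algebra : ∀ A B X G → A *ₚ B +ₚ X *ₚ (A *ₚ G) ≋ A *ₚ (B +ₚ X *ₚ G)
  algebra = solve-∀ Poly-ring

substPow-0∷ : ∀ p h → substPow p (0ℤ ∷ h) ≋ xpow p *ₚ substPow p h
substPow-0∷ p h = +-cong const-0 ≋-refl

substPow-* : ∀ p f g → substPow p (f *ₚ g) ≋ substPow p f *ₚ substPow p g
substPow-* p [] g = ≋-refl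
substPow-* p (a ∷ f) g =
  substPow-+ p (scaleₚ a g) (0ℤ ∷ (f *ₚ g))
  ⟨≋⟩ +-cong (substPow-scale p a g) (substPow-0∷ p (f *ₚ g) ⟨≋⟩ *-congʳ (xpow p) (substPow-* p f g))
  ⟨≋⟩ algebra (const a) (xpow p) (substPow p f) (substPow p g)
  where
  algebra : ∀ A X F G → A *ₚ G +ₚ X *ₚ (F *ₚ G) ≋ (A +ₚ X *ₚ F) *ₚ G
  algebra = solve-∀ Poly-ring

substPow-neg : ∀ p f → substPow p (negₚ f) ≋ negₚ (substPow p f)
substPow-neg p [] = ≋-refl
substPow-neg p (a ∷ f) = +-cong ≋-refl (*-congʳ (xpow p) (substPow-neg p f)) ⟨≋⟩ algebra (const a) (xpow p) (substPow p f)
  where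
  algebra : ∀ A X F → negₚ A +ₚ X *ₚ negₚ F ≋ negₚ (A +ₚ X *ₚ F)
  algebra = solve-∀ Poly-ring

substPow-≋[] : ∀ p {f} → f ≋ [] → substPow p f ≋ []
substPow-≋[] p {[]} e = ≋-refl
substPow-≋[] p {a ∷ f} (coeffwise e) =
  +-cong (≡⇒≋ (cong const (e 0)) ⟨≋⟩ const-0)
         (*-congʳ (xpow p) (substPow-≋[] p {f} (coeffwise λ k → e (suc k))) ⟨≋⟩ *-zeroʳ (xpow p))

substPow-cong : ∀ p {f g} → f ≋ g → substPow p f ≋ substPow p g
substPow-cong p {f} {g} e =
  add-back (substPow p f) (substPow p g)
  ⟨≋⟩ +-cong (≋-sym (substPow-+ p f (negₚ g) ⟨≋⟩ +-cong (≋-refl {substPow p f}) (substPow-neg p g))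
              ⟨≋⟩ substPow-≋[] p (+-cong e (≋-refl {negₚ g}) ⟨≋⟩ -‿inverseʳ g))
             (≋-refl {substPow p g})
  where
  add-back : ∀ A B → A ≋ (A -ₚ B) +ₚ B
  add-back = solve-∀ Poly-ring

substPow-oneₚ : ∀ p → substPow p oneₚ ≋ oneₚ
substPow-oneₚ p = +-cong (≋-refl {oneₚ}) (*-zeroʳ (xpow p)) ⟨≋⟩ +-identityʳ oneₚ

substPow-xpow : ∀ p m → substPow p (xpow m) ≋ xpow (p ℕ.* m)
substPow-xpow p zero = substPow-oneₚ p ⟨≋⟩ ≡⇒≋ (cong xpow (sym (ℕP.*-zeroʳ p)))
substPow-xpow p (suc m) =
  substPow-0∷ p (xpow m) ⟨≋⟩ *-congʳ (xpow p) (substPow-xpow p m)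
  ⟨≋⟩ ≋-sym (xpow-+ p (p ℕ.* m)) ⟨≋⟩ ≡⇒≋ (cong xpow (sym (ℕP.*-suc p m)))

substPow-xpow-1 : ∀ p m → substPow p (xpow-1 m) ≋ xpow-1 (p ℕ.* m)
substPow-xpow-1 p m =
  substPow-+ p (xpow m) (negₚ oneₚ) ⟨≋⟩ +-cong (substPow-xpow p m) (substPow-neg p oneₚ ⟨≋⟩ neg-cong (substPow-oneₚ p))

substPow-∏ : ∀ p (c : ℕ → Bool) (f : ℕ → Poly) N → substPow p (∏ c f N) ≋ ∏ c (λ d → substPow p (f d)) N
substPow-∏ p c f zero = substPow-oneₚ p
substPow-∏ p c f (suc N) = substPow-* p (∏ c f N) (factorIf c f N) ⟨≋⟩ *-cong (substPow-∏ p c f N) last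
  where
  last : substPow p (factorIf c f N) ≋ factorIf c (λ d → substPow p (f d)) N
  last with c N
  ... | true = ≋-refl
  ... | false = substPow-oneₚ p

coeff-xpow-*-shift : ∀ p f k → coeff (xpow p *ₚ f) (p ℕ.+ k) ≡ coeff f k
coeff-xpow-*-shift zero f k = coeff≡ (*-identityˡ f) k
coeff-xpow-*-shift (suc p) f k = trans (coeff≡ (0∷-* (xpow p) f) (suc (p ℕ.+ k))) (coeff-xpow-*-shift p f k)

coeff-xpow-*-low : ∀ p f t → t < p → coeff (xpow p *ₚ f) t ≡ 0ℤ
coeff-xpow-*-low (suc p) f zero lt = coeff≡ (0∷-* (xpow p) f) zero
coeff-xpow-*-low (suc p) f (suc t) (s≤s lt) = trans (coeff≡ (0∷-* (xpow p) f) (suc t)) (coeff-xpow-*-low p f t lt)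

-- If deg B < p, the translates x^(i p) B of B do not overlap.
coeff-substPow-* : ∀ p B → Deg< B p → ∀ A i t → t < p → coeff (substPow p A *ₚ B) (i ℕ.* p ℕ.+ t) ≡ coeff A i ℤ.* coeff B t
coeff-substPow-* p B dB [] i t lt = sym (ℤP.*-zeroˡ (coeff B t))
coeff-substPow-* p B dB (a ∷ A) i t lt =
  trans (coeff≡ (*-distribʳ B (const a) (xpow p *ₚ substPow p A) ⟨≋⟩ +-cong (≋-refl {const a *ₚ B}) (*-assoc (xpow p) (substPow p A) B)) (i ℕ.* p ℕ.+ t))
    (trans (coeff-+ (const a *ₚ B) (xpow p *ₚ (substPow p A *ₚ B)) (i ℕ.* p ℕ.+ t))
      (trans (cong (ℤ._+ coeff (xpow p *ₚ (substPow p A *ₚ B)) (i ℕ.* p ℕ.+ t)) (coeff-const-* a B (i ℕ.* p ℕ.+ t))) (go i)))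
  where
  go : ∀ i → a ℤ.* coeff B (i ℕ.* p ℕ.+ t) ℤ.+ coeff (xpow p *ₚ (substPow p A *ₚ B)) (i ℕ.* p ℕ.+ t) ≡ coeff (a ∷ A) i ℤ.* coeff B t
  go zero = trans (cong (ℤ._+_ (a ℤ.* coeff B t)) (coeff-xpow-*-low p (substPow p A *ₚ B) t lt)) (ℤP.+-identityʳ _)
  go (suc i) =
    trans (cong₂ ℤ._+_ (trans (cong (a ℤ.*_) (vanish dB (suc i ℕ.* p ℕ.+ t) (ℕP.≤-trans (ℕP.m≤m+n p (i ℕ.* p)) (ℕP.m≤m+n _ t))))
                              (ℤP.*-zeroʳ a))
                       (trans (cong (coeff (xpow p *ₚ (substPow p A *ₚ B))) (ℕP.+-assoc p (i ℕ.* p) t))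
                              (coeff-xpow-*-shift p (substPow p A *ₚ B) (i ℕ.* p ℕ.+ t))))
      (trans (ℤP.+-identityˡ _) (coeff-substPow-* p B dB A i t lt))

Monic-substPow : ∀ p f D → 1 ≤ p → Monic f D → Monic (substPow p f) (D ℕ.* p)
Monic-substPow (suc p′) f D _ (cf , df) =
  trans (coeff-substPow-1 (D ℕ.* p) D 0 (s≤s z≤n) (ℕP.+-identityʳ (D ℕ.* p))) (trans (ℤP.*-identityʳ _) cf)
  , deg< above
  where
  p = suc p′
  deg1 : Deg< oneₚ p
  deg1 = deg< λ { (suc k) _ → refl }
  coeff-substPow-1 : ∀ k i t → t < p → i ℕ.* p ℕ.+ t ≡ k → coeff (substPow p f) k ≡ coeff f i ℤ.* coeff oneₚ t
  coeff-substPow-1 k i t t<p refl =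
    trans (sym (coeff≡ (*-identityʳ (substPow p f)) k)) (coeff-substPow-* p oneₚ deg1 f i t t<p)
  above : ∀ k → suc (D ℕ.* p) ≤ k → coeff (substPow p f) k ≡ 0ℤ
  above k le with k % p in r≡ | coeff-substPow-1 k (k / p) (k % p) (m%n<n k p) (sym (trans (m≡m%n+[m/n]*n k p) (ℕP.+-comm (k % p) _)))
  ... | suc t | e = trans e (ℤP.*-zeroʳ (coeff f (k / p)))
  ... | zero | e = trans e (cong (ℤ._* 1ℤ) (vanish df (k / p) D<k/p))
    where
    k≡ : k ≡ (k / p) ℕ.* p
    k≡ = trans (m≡m%n+[m/n]*n k p) (cong (ℕ._+ (k / p) ℕ.* p) r≡)
    D<k/p : suc D ≤ k / p
    D<k/p = ℕP.≰⇒> (λ le′ → ℕP.<⇒≱ (ℕP.<-≤-trans le (ℕP.≤-reflexive k≡)) (ℕP.*-monoˡ-≤ p le′))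

-- Substituting x^p into Φ m

≡true-ext : ∀ {x y : Bool} → (x ≡ true → y ≡ true) → (y ≡ true → x ≡ true) → x ≡ y
≡true-ext {true} {true} _ _ = refl
≡true-ext {true} {false} f _ = sym (f refl)
≡true-ext {false} {true} _ g = g refl
≡true-ext {false} {false} _ _ = refl

isMultipleOf : ℕ → ℕ → Bool
isMultipleOf p d = ⌊ p ∣? d ⌋

isMultipleOf-true : ∀ {p d} → p ∣ d → isMultipleOf p d ≡ true
isMultipleOf-true {p} {d} p∣d with p ∣? d
... | yes _ = refl
... | no p∤d = ⊥-elim (p∤d p∣d)

isMultipleOf-false : ∀ {p d} → ¬ p ∣ d → isMultipleOf p d ≡ false
isMultipleOf-false {p} {d} p∤d with p ∣? d
... | yes p∣d = ⊥-elim (p∤d p∣d)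
... | no _ = refl

module SubstPrime (p : ℕ) (p-prime : Prime p) where

  instance
    p≢0 : NonZero p
    p≢0 = prime⇒nonZero p-prime

  1≤p : 1 ≤ p
  1≤p = ℕ.>-nonZero⁻¹ p

  coprime-to-p : ∀ {d} → ¬ p ∣ d → Coprime d p
  coprime-to-p {d} p∤d {i} (i∣d , i∣p) with prime⇒irreducible p-prime i∣p
  ... | inj₁ i≡1 = i≡1
  ... | inj₂ refl = ⊥-elim (p∤d i∣d)

  Φ-unlessMultiple : ℕ → Poly
  Φ-unlessMultiple e = if isMultipleOf p e then oneₚ else Φ e

  substPowΦ : ℕ → Poly
  substPowΦ e = Φ (p ℕ.* e) *ₚ Φ-unlessMultiple e

  isDivisor-p*-multiple : ∀ m e → (isDivisor (p ℕ.* m) (p ℕ.* e) ∧ isMultipleOf p (p ℕ.* e)) ≡ isDivisor m e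
  isDivisor-p*-multiple m e
    rewrite isMultipleOf-true {p} {p ℕ.* e} (m∣m*n e) | BoolP.∧-identityʳ (isDivisor (p ℕ.* m) (p ℕ.* e)) =
    ≡true-ext (λ t → let (1≤pe , pe∣pm) = isDivisor-sound {p ℕ.* m} {p ℕ.* e} t in isDivisor-true (positive 1≤pe) (*-cancelˡ-∣ p pe∣pm))
              (λ t → let (1≤e , e∣m) = isDivisor-sound {m} {e} t in isDivisor-true (ℕP.*-mono-≤ 1≤p 1≤e) (*-monoʳ-∣ p e∣m))
    where
    positive : ∀ {e} → 1 ≤ p ℕ.* e → 1 ≤ e
    positive {zero} le = ⊥-elim (ℕP.<⇒≱ le (ℕP.≤-reflexive (ℕP.*-zeroʳ p)))
    positive {suc e} _ = s≤s z≤n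

  isDivisor-p*-nonMultiple : ∀ m d → (isDivisor (p ℕ.* m) d ∧ not (isMultipleOf p d)) ≡ (isDivisor m d ∧ not (isMultipleOf p d))
  isDivisor-p*-nonMultiple m d with p ∣? d
  ... | yes _ = trans (BoolP.∧-zeroʳ _) (sym (BoolP.∧-zeroʳ _))
  ... | no p∤d = trans (BoolP.∧-identityʳ _) (trans
      (≡true-ext (λ t → let (1≤d , d∣pm) = isDivisor-sound {p ℕ.* m} {d} t in isDivisor-true 1≤d (coprime-divisor (coprime-to-p p∤d) d∣pm))
                 (λ t → let (1≤d , d∣m) = isDivisor-sound {m} {d} t in isDivisor-true 1≤d (∣n⇒∣m*n p d∣m)))
      (sym (BoolP.∧-identityʳ _)))

  -- Split the divisors of p m into the multiples p e of p (e ∣ m) and the divisors of m prime to p.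
  module DivisorsOfPM (m : ℕ) (1≤m : 1 ≤ m) where

    isMultiple = isMultipleOf p
    multiple = λ d → isDivisor (p ℕ.* m) d ∧ isMultiple d
    nonMultiple = λ d → isDivisor (p ℕ.* m) d ∧ not (isMultiple d)

    p′ = p ∸ 1
    p≡ : p ≡ suc p′
    p≡ = trans (sym (ℕP.m∸n+n≡m 1≤p)) (ℕP.+-comm p′ 1)

    bound : suc (p ℕ.* m) ℕ.+ p′ ≡ p ℕ.* suc m
    bound = trans (cong suc (ℕP.+-comm (p ℕ.* m) p′)) (trans (cong (ℕ._+ p ℕ.* m) (sym p≡)) (sym (ℕP.*-suc p m)))

    ∏-multiples-of-p : ∏ multiple Φ (suc (p ℕ.* m)) ≋ ∏ (isDivisor m) (λ e → Φ (p ℕ.* e)) (suc m)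
    ∏-multiples-of-p =
      ≋-sym (*-identityʳ _)
      ⟨≋⟩ *-congʳ (∏ multiple Φ (suc (p ℕ.* m)))
            (≋-sym (∏-none _ _ p′ (λ j _ → cong (_∧ isMultiple (suc (p ℕ.* m) ℕ.+ j))
                                                 (isDivisor-> (ℕP.*-mono-≤ 1≤p 1≤m) (s≤s (ℕP.m≤m+n (p ℕ.* m) j))))))
      ⟨≋⟩ ≋-sym (∏-+ multiple Φ (suc (p ℕ.* m)) p′)
      ⟨≋⟩ ≡⇒≋ (cong (∏ multiple Φ) bound)
      ⟨≋⟩ ∏-multiples p multiple Φ 1≤p (λ d p∤d → trans (cong (isDivisor (p ℕ.* m) d ∧_) (isMultipleOf-false p∤d)) (BoolP.∧-zeroʳ _)) (suc m)
      ⟨≋⟩ ∏-cong (suc m) (λ e _ → factorIf-condition {λ e → multiple (p ℕ.* e)} {isDivisor m} (λ e → Φ (p ℕ.* e)) e (isDivisor-p*-multiple m e))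

    ∏-non-multiples-of-p : ∏ nonMultiple Φ (suc (p ℕ.* m)) ≋ ∏ (isDivisor m) Φ-unlessMultiple (suc m)
    ∏-non-multiples-of-p =
      ∏-cong (suc (p ℕ.* m)) (λ d _ → factorIf-condition {nonMultiple} {coprimeDivisor} Φ d (isDivisor-p*-nonMultiple m d))
      ⟨≋⟩ ≡⇒≋ (cong (∏ coprimeDivisor Φ) (sym m+[pm-m]))
      ⟨≋⟩ ∏-+ coprimeDivisor Φ (suc m) (p ℕ.* m ∸ m)
      ⟨≋⟩ *-congʳ (∏ coprimeDivisor Φ (suc m))
            (∏-none _ _ (p ℕ.* m ∸ m) (λ j _ → cong (λ b → b ∧ not (isMultiple (suc m ℕ.+ j))) (isDivisor-> 1≤m (s≤s (ℕP.m≤m+n m j)))))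
      ⟨≋⟩ *-identityʳ _
      ⟨≋⟩ ∏-cong (suc m) (λ d _ → same-factor d)
      where
      coprimeDivisor = λ d → isDivisor m d ∧ not (isMultiple d)
      m+[pm-m] : suc m ℕ.+ (p ℕ.* m ∸ m) ≡ suc (p ℕ.* m)
      m+[pm-m] = cong suc (ℕP.m+[n∸m]≡n (ℕP.m≤n*m m p))
      same-factor : ∀ d → factorIf coprimeDivisor Φ d ≋ factorIf (isDivisor m) Φ-unlessMultiple d
      same-factor d with isDivisor m d | isMultiple d
      ... | true | true = ≋-refl
      ... | true | false = ≋-refl
      ... | false | _ = ≋-refl

    divisorProduct-p* : divisorProduct (p ℕ.* m) ≋ ∏ (isDivisor m) substPowΦ (suc m)
    divisorProduct-p* =
      ∏-split (isDivisor (p ℕ.* m)) isMultiple Φ (suc (p ℕ.* m))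
      ⟨≋⟩ *-cong ∏-multiples-of-p ∏-non-multiples-of-p
      ⟨≋⟩ ≋-sym (∏-* (isDivisor m) (λ e → Φ (p ℕ.* e)) Φ-unlessMultiple (suc m))

  substPowΦ-Monic : ∀ e → 1 ≤ e → Σ ℕ (Monic (substPowΦ e))
  substPowΦ-Monic e 1≤e with isMultipleOf p e
  ... | true = _ , Monic-* (Factorisation.Φ-monic (factorisation (p ℕ.* e) (ℕP.*-mono-≤ 1≤p 1≤e))) Monic-oneₚ
  ... | false = _ , Monic-* (Factorisation.Φ-monic (factorisation (p ℕ.* e) (ℕP.*-mono-≤ 1≤p 1≤e)))
                              (Factorisation.Φ-monic (factorisation e 1≤e))

  -- Substitute x^p into x^m - 1 = ∏_{e ∣ m} Φ e and compare with x^(pm) - 1 = ∏_{e ∣ m} substPowΦ e;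
  -- by induction all factors with e < m agree, so the remaining ones agree too.
  substPow-Φ : ∀ m → 1 ≤ m → substPow p (Φ m) ≋ substPowΦ m
  substPow-Φ = <-rec (λ m → 1 ≤ m → substPow p (Φ m) ≋ substPowΦ m) step
    where
    step : ∀ m → (∀ {e} → e < m → 1 ≤ e → substPow p (Φ e) ≋ substPowΦ e) → 1 ≤ m → substPow p (Φ m) ≋ substPowΦ m
    step m IH 1≤m = *-cancelˡ-Monic (proj₂ others-monic) (≋-sym via-Φ ⟨≋⟩ via-substPowΦ)
      where
      others = ∏ (isDivisor m) substPowΦ m
      others-monic = ∏-Monic (isDivisor m) substPowΦ m (λ e _ e∣m → substPowΦ-Monic e (proj₁ (isDivisor-sound e∣m)))
      via-Φ : substPow p (xpow-1 m) ≋ others *ₚ substPow p (Φ m)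
      via-Φ =
        substPow-cong p (Factorisation.xpow-1≋divisorProduct (factorisation m 1≤m) 1≤m)
        ⟨≋⟩ substPow-∏ p (isDivisor m) Φ (suc m)
        ⟨≋⟩ *-cong (∏-cong m (λ e e<m → factorIf-cong (isDivisor m) (λ d → substPow p (Φ d)) substPowΦ e
                                           (λ e∣m → IH e<m (proj₁ (isDivisor-sound e∣m)))))
                   (factorIf-isDivisor-self m 1≤m (λ d → substPow p (Φ d)))
      via-substPowΦ : substPow p (xpow-1 m) ≋ others *ₚ substPowΦ m
      via-substPowΦ =
        substPow-xpow-1 p m
        ⟨≋⟩ Factorisation.xpow-1≋divisorProduct (factorisation (p ℕ.* m) pm≥1) pm≥1
        ⟨≋⟩ DivisorsOfPM.divisorProduct-p* m 1≤m
        ⟨≋⟩ *-congʳ others (factorIf-isDivisor-self m 1≤m substPowΦ)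
        where
        pm≥1 = ℕP.*-mono-≤ 1≤p 1≤m

-- Cyclotomic polynomials are not constant

∃-prime-divisor : ∀ n → 2 ≤ n → Σ ℕ λ p → Prime p × p ∣ n
∃-prime-divisor = <-rec (λ n → 2 ≤ n → Σ ℕ λ p → Prime p × p ∣ n) go
  where
  go : ∀ n → (∀ {m} → m < n → 2 ≤ m → Σ ℕ λ p → Prime p × p ∣ m) → 2 ≤ n → Σ ℕ λ p → Prime p × p ∣ n
  go n rec 2≤n with prime? n
  ... | yes n-prime = n , n-prime , ∣-refl
  ... | no ¬n-prime with ¬prime⇒composite {{n>1⇒nonTrivial 2≤n}} ¬n-prime
  ...   | hasNonTrivialDivisor {d} d<n d∣n with rec d<n (nonTrivial⇒n>1 d)
  ...     | p , p-prime , p∣d = p , p-prime , ∣-trans p∣d d∣n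

Monic-Φ1 : Monic (Φ 1) 1
Monic-Φ1 = refl , deg< λ { (suc (suc k)) _ → refl ; (suc zero) (s≤s ()) }

-- For n = p m with p prime, comparing degrees in Φ m (x^p) = Φ n · (1 or Φ m)
-- gives deg Φ n = p deg Φ m or (p - 1) deg Φ m.
Φ-degree≥1 : ∀ n → 1 ≤ n → ∀ D → Monic (Φ n) D → 1 ≤ D
Φ-degree≥1 = <-rec (λ n → 1 ≤ n → ∀ D → Monic (Φ n) D → 1 ≤ D) go
  where
  go : ∀ n → (∀ {m} → m < n → 1 ≤ m → ∀ D → Monic (Φ m) D → 1 ≤ D) → 1 ≤ n → ∀ D → Monic (Φ n) D → 1 ≤ D
  go (suc zero) rec _ D mD = ℕP.≤-reflexive (Monic-degree-unique Monic-Φ1 mD)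
  go n@(suc (suc n′)) rec _ D mD with ∃-prime-divisor n (s≤s (s≤s z≤n))
  ... | p , p-prime , divides m n≡m*p = degree-cases (isMultipleOf p m) refl
    where
    open SubstPrime p p-prime using (Φ-unlessMultiple; substPow-Φ; 1≤p)
    2≤p : 2 ≤ p
    2≤p = nonTrivial⇒n>1 p {{prime⇒nonTrivial p-prime}}
    1≤m : 1 ≤ m
    1≤m = ℕP.n≢0⇒n>0 λ m≡0 → ℕP.1+n≢0 (trans n≡m*p (cong (ℕ._* p) m≡0))
    m<n : m < n
    m<n = ℕP.<-≤-trans (ℕP.m<m*n m p {{ℕ.>-nonZero 1≤m}} 2≤p) (ℕP.≤-reflexive (sym n≡m*p))
    Dm = Factorisation.degree (factorisation m 1≤m)
    mDm = Factorisation.Φ-monic (factorisation m 1≤m)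
    1≤Dm : 1 ≤ Dm
    1≤Dm = rec m<n 1≤m Dm mDm
    Monic-Φpm : Monic (Φ (p ℕ.* m)) D
    Monic-Φpm = subst (λ k → Monic (Φ k) D) (trans n≡m*p (ℕP.*-comm m p)) mD
    Monic-Φm[xᵖ] : Monic (Φ (p ℕ.* m) *ₚ Φ-unlessMultiple m) (Dm ℕ.* p)
    Monic-Φm[xᵖ] = Monic-resp (substPow-Φ m 1≤m) (Monic-substPow p (Φ m) Dm 1≤p mDm)
    degree-cases : ∀ b → isMultipleOf p m ≡ b → 1 ≤ D
    degree-cases true e = ℕP.≤-trans (ℕP.*-mono-≤ 1≤Dm 1≤p)
      (ℕP.≤-reflexive (trans (Monic-degree-unique Monic-Φm[xᵖ] (Monic-* Monic-Φpm Monic-unlessMultiple)) (ℕP.+-identityʳ D)))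
      where
      Monic-unlessMultiple : Monic (Φ-unlessMultiple m) 0
      Monic-unlessMultiple = subst (λ z → Monic z 0) (sym (cong (λ b → if b then oneₚ else Φ m) e)) Monic-oneₚ
    degree-cases false e = ℕP.n≢0⇒n>0 λ D≡0 → ℕP.<⇒≢ 2≤p (sym (ℕP.*-cancelˡ-≡ p 1 Dm {{ℕ.>-nonZero 1≤Dm}} (Dm*p≡Dm D≡0)))
      where
      Monic-unlessMultiple : Monic (Φ-unlessMultiple m) Dm
      Monic-unlessMultiple = subst (λ z → Monic z Dm) (sym (cong (λ b → if b then oneₚ else Φ m) e)) mDm
      Dm*p≡Dm : D ≡ 0 → Dm ℕ.* p ≡ Dm ℕ.* 1
      Dm*p≡Dm D≡0 = trans (Monic-degree-unique Monic-Φm[xᵖ] (Monic-* Monic-Φpm Monic-unlessMultiple))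
                          (trans (cong (ℕ._+ Dm) D≡0) (sym (ℕP.*-identityʳ Dm)))

-- Truncation and rotation

coeff-applyUpTo-< : ∀ (g : ℕ → ℤ) n k → k < n → coeff (applyUpTo g n) k ≡ g k
coeff-applyUpTo-< g (suc n) zero _ = refl
coeff-applyUpTo-< g (suc n) (suc k) (s≤s lt) = coeff-applyUpTo-< (λ x → g (suc x)) n k lt

coeff-applyUpTo-≥ : ∀ (g : ℕ → ℤ) n k → n ≤ k → coeff (applyUpTo g n) k ≡ 0ℤ
coeff-applyUpTo-≥ g zero k _ = refl
coeff-applyUpTo-≥ g (suc n) (suc k) (s≤s le) = coeff-applyUpTo-≥ (λ x → g (suc x)) n k le

coeff-map-upTo-< : ∀ (g : ℕ → ℤ) n k → k < n → coeff (map g (upTo n)) k ≡ g k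
coeff-map-upTo-< g n k lt = trans (cong (λ l → coeff l k) (ListP.map-applyUpTo (λ x → x) g n)) (coeff-applyUpTo-< g n k lt)

coeff-map-upTo-≥ : ∀ (g : ℕ → ℤ) n k → n ≤ k → coeff (map g (upTo n)) k ≡ 0ℤ
coeff-map-upTo-≥ g n k le = trans (cong (λ l → coeff l k) (ListP.map-applyUpTo (λ x → x) g n)) (coeff-applyUpTo-≥ g n k le)

coeff-take-< : ∀ s h k → k < s → coeff (take s h) k ≡ coeff h k
coeff-take-< (suc s) [] k _ = refl
coeff-take-< (suc s) (a ∷ h) zero _ = refl
coeff-take-< (suc s) (a ∷ h) (suc k) (s≤s lt) = coeff-take-< s h k lt

coeff-take-≥ : ∀ s h k → s ≤ k → coeff (take s h) k ≡ 0ℤ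
coeff-take-≥ zero h k _ = refl
coeff-take-≥ (suc s) [] k _ = refl
coeff-take-≥ (suc s) (a ∷ h) (suc k) (s≤s le) = coeff-take-≥ s h k le

coeff-drop : ∀ s h k → coeff (drop s h) k ≡ coeff h (s ℕ.+ k)
coeff-drop zero h k = refl
coeff-drop (suc s) [] k = refl
coeff-drop (suc s) (a ∷ h) k = coeff-drop s h k

≋xpow-*-drop+take : ∀ s h → h ≋ xpow s *ₚ drop s h +ₚ take s h
≋xpow-*-drop+take zero h = ≋-sym (+-identityʳ _ ⟨≋⟩ *-identityˡ h)
≋xpow-*-drop+take (suc s) [] = ≋-sym (+-identityʳ _ ⟨≋⟩ *-zeroʳ (xpow (suc s)))
≋xpow-*-drop+take (suc s) (a ∷ h) =
  ≋-sym (+-cong (0∷-* (xpow s) (drop s h)) (≋-refl {a ∷ take s h}) ⟨≋⟩ ∷-cong (ℤP.+-identityˡ a) (≋-sym (≋xpow-*-drop+take s h)))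

Deg<-take : ∀ s h → Deg< (take s h) s
Deg<-take s h = deg< λ k le → coeff-take-≥ s h k le

𝒯≋take : ∀ s h → 𝒯 s h ≋ take s h
𝒯≋take s h = proj₁ (quot-rem-unique h (xpow s) s (drop s h) (take s h) (Monic-xpow s)
  (≋xpow-*-drop+take s h ⟨≋⟩ +-cong (*-comm (xpow s) (drop s h)) (≋-refl {take s h})) (Deg<-take s h))

rotate : ℕ → ℕ → Poly → Poly
rotate m r h = drop r h +ₚ xpow (m ∸ r) *ₚ take r h

Deg<-rotate : ∀ m r h → r ≤ m → Deg< h m → Deg< (rotate m r h) m
Deg<-rotate m r h r≤m dh = deg< go
  where
  go : ∀ k → m ≤ k → coeff (rotate m r h) k ≡ 0ℤ
  go k m≤k =
    trans (coeff-+ (drop r h) (xpow (m ∸ r) *ₚ take r h) k)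
      (cong₂ ℤ._+_ (trans (coeff-drop r h k) (vanish dh (r ℕ.+ k) (ℕP.≤-trans m≤k (ℕP.m≤n+m k r))))
                   (trans (cong (coeff (xpow (m ∸ r) *ₚ take r h)) (sym k≡))
                          (trans (coeff-xpow-*-shift (m ∸ r) (take r h) (k ∸ (m ∸ r))) (coeff-take-≥ r h (k ∸ (m ∸ r)) r≤))))
    where
    k≡ : (m ∸ r) ℕ.+ (k ∸ (m ∸ r)) ≡ k
    k≡ = ℕP.m+[n∸m]≡n (ℕP.≤-trans (ℕP.m∸n≤m m r) m≤k)
    r≤ : r ≤ k ∸ (m ∸ r)
    r≤ = ℕP.+-cancelˡ-≤ (m ∸ r) r (k ∸ (m ∸ r)) (subst₂ _≤_ (sym (ℕP.m∸n+n≡m r≤m)) (sym k≡) m≤k)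

ℛ≋rotate : ∀ m r h → 1 ≤ m → r ≤ m → Deg< h m → ℛ m r h ≋ rotate m r h
ℛ≋rotate m r h 1≤m r≤m dh =
  proj₁ (quot-rem-unique (xpow (m ∸ r) *ₚ h) (xpow-1 m) m (drop r h) (rotate m r h) (Monic-xpow-1 m 1≤m)
    ( *-congʳ (xpow (m ∸ r)) (≋xpow-*-drop+take r h)
      ⟨≋⟩ algebra (xpow (m ∸ r)) (xpow r) (drop r h) (take r h)
      ⟨≋⟩ +-cong (*-congʳ (drop r h) (+-cong (≋-sym (xpow-+ (m ∸ r) r) ⟨≋⟩ ≡⇒≋ (cong xpow (ℕP.m∸n+n≡m r≤m))) (≋-refl {negₚ oneₚ})))
                 (≋-refl {rotate m r h}) )
    (Deg<-rotate m r h r≤m dh))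
  where
  algebra : ∀ Y Z D T → Y *ₚ (Z *ₚ D +ₚ T) ≋ D *ₚ (Y *ₚ Z -ₚ oneₚ) +ₚ (D +ₚ Y *ₚ T)
  algebra = solve-∀ Poly-ring

coeff-rotate-< : ∀ m r h k → k < m ∸ r → coeff (rotate m r h) k ≡ coeff h (r ℕ.+ k)
coeff-rotate-< m r h k lt =
  trans (coeff-+ (drop r h) (xpow (m ∸ r) *ₚ take r h) k)
    (trans (cong₂ ℤ._+_ (coeff-drop r h k) (coeff-xpow-*-low (m ∸ r) (take r h) k lt)) (ℤP.+-identityʳ _))

coeff-rotate-wrap : ∀ m r h k → r ≤ m → Deg< h m → k < r → coeff (rotate m r h) ((m ∸ r) ℕ.+ k) ≡ coeff h k
coeff-rotate-wrap m r h k r≤m dh lt =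
  trans (coeff-+ (drop r h) (xpow (m ∸ r) *ₚ take r h) ((m ∸ r) ℕ.+ k))
    (trans (cong₂ ℤ._+_ (trans (coeff-drop r h _) (vanish dh _ m≤))
                        (trans (coeff-xpow-*-shift (m ∸ r) (take r h) k) (coeff-take-< r h k lt)))
           (ℤP.+-identityˡ _))
  where
  m≤ : m ≤ r ℕ.+ ((m ∸ r) ℕ.+ k)
  m≤ = subst (_≤ r ℕ.+ ((m ∸ r) ℕ.+ k)) (ℕP.m+[n∸m]≡n r≤m) (ℕP.+-monoʳ-≤ r (ℕP.m≤m+n (m ∸ r) k))

-- The blocks of Φ (m p)

coeff-fBlock-< : ∀ m p i k → k < p → coeff (fBlock m p i) k ≡ coeff (Φ (m ℕ.* p)) (i ℕ.* p ℕ.+ k)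
coeff-fBlock-< m p i = coeff-map-upTo-< (λ k → coeff (Φ (m ℕ.* p)) (i ℕ.* p ℕ.+ k)) p

coeff-fBlock-≥ : ∀ m p i k → p ≤ k → coeff (fBlock m p i) k ≡ 0ℤ
coeff-fBlock-≥ m p i = coeff-map-upTo-≥ (λ k → coeff (Φ (m ℕ.* p)) (i ℕ.* p ℕ.+ k)) p

coeff-fBlock2-< : ∀ m p i j k → k < m → coeff (fBlock2 m p i j) k ≡ coeff (fBlock m p i) (j ℕ.* m ℕ.+ k)
coeff-fBlock2-< m p i j = coeff-map-upTo-< (λ k → coeff (fBlock m p i) (j ℕ.* m ℕ.+ k)) m

coeff-fBlock2-≥ : ∀ m p i j k → m ≤ k → coeff (fBlock2 m p i j) k ≡ 0ℤ
coeff-fBlock2-≥ m p i j = coeff-map-upTo-≥ (λ k → coeff (fBlock m p i) (j ℕ.* m ℕ.+ k)) m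

≋-below : ∀ {f g} n → Deg< f n → Deg< g n → (∀ k → k < n → coeff f k ≡ coeff g k) → f ≋ g
≋-below {f} {g} n df dg e = coeffwise λ k → by-cases k (k ℕ.<? n)
  where
  by-cases : ∀ k → Dec (k < n) → coeff f k ≡ coeff g k
  by-cases k (yes k<n) = e k k<n
  by-cases k (no k≮n) = trans (vanish df k (ℕP.≮⇒≥ k≮n)) (sym (vanish dg k (ℕP.≮⇒≥ k≮n)))

module Blocks (m p : ℕ) .{{_ : NonZero m}} (p-prime : Prime p) (m<p : m < p) where

  open SubstPrime p p-prime using (substPow-Φ)

  1≤m : 1 ≤ m
  1≤m = ℕ.>-nonZero⁻¹ m

  open Factorisation (factorisation m 1≤m)

  Ψ≋properDivisorProduct : Ψ m ≋ properDivisorProduct m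
  Ψ≋properDivisorProduct =
    proj₂ (quot-rem-unique (xpow-1 m) (Φ m) degree (properDivisorProduct m) [] Φ-monic
             (xpow-1≋ ⟨≋⟩ *-comm (Φ m) (properDivisorProduct m) ⟨≋⟩ ≋-sym (+-identityʳ _)) (deg< λ _ _ → refl))

  Deg<-Ψ : Deg< (Ψ m) m
  Deg<-Ψ = Deg<-resp (≋-sym Ψ≋properDivisorProduct) (Deg<-mono proper-degree<m (proj₂ proper-monic))
    where
    proper-degree<m : suc proper-degree ≤ m
    proper-degree<m =
      subst (suc proper-degree ≤_)
        (Monic-degree-unique (Monic-resp (≋-sym xpow-1≋) (Monic-* Φ-monic proper-monic)) (Monic-xpow-1 m 1≤m))
        (ℕP.+-monoˡ-≤ proper-degree (Φ-degree≥1 m 1≤m degree Φ-monic))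

  substPow-Φm≋ : substPow p (Φ m) ≋ Φ (m ℕ.* p) *ₚ Φ m
  substPow-Φm≋ =
    substPow-Φ m 1≤m
    ⟨≋⟩ *-cong (≡⇒≋ (cong Φ (ℕP.*-comm p m))) (≡⇒≋ (cong (λ b → if b then oneₚ else Φ m) (isMultipleOf-false p∤m)))
    where
    p∤m : ¬ p ∣ m
    p∤m p∣m = ℕP.<⇒≱ m<p (∣⇒≤ p∣m)

  Φmp*xpow-1≋ : Φ (m ℕ.* p) *ₚ xpow-1 m ≋ substPow p (Φ m) *ₚ Ψ m
  Φmp*xpow-1≋ =
    *-congʳ (Φ (m ℕ.* p)) (xpow-1≋ ⟨≋⟩ *-congʳ (Φ m) (≋-sym Ψ≋properDivisorProduct))
    ⟨≋⟩ ≋-sym (*-assoc (Φ (m ℕ.* p)) (Φ m) (Ψ m)) ⟨≋⟩ *-congˡ (Ψ m) (≋-sym substPow-Φm≋)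

  c a ψ h : ℕ → ℤ
  c = coeff (Φ (m ℕ.* p))
  a = coeff (Φ m)
  ψ = coeff (Ψ m)
  h = coeff (substPow p (Φ m) *ₚ Ψ m)

  c-+m : ∀ k → c (m ℕ.+ k) ≡ c k ℤ.- h (m ℕ.+ k)
  c-+m k = trans (solve-for (c k) (c (m ℕ.+ k))) (cong (ℤ._-_ (c k)) difference)
    where
    solve-for : ∀ x y → y ≡ x ℤ.- (x ℤ.- y)
    solve-for = ℤ-Solver.solve-∀
    expand : ∀ F Y → F *ₚ (Y -ₚ oneₚ) ≋ Y *ₚ F -ₚ F
    expand = solve-∀ Poly-ring
    difference : c k ℤ.- c (m ℕ.+ k) ≡ h (m ℕ.+ k)
    difference =
      trans (sym (trans (coeff≡ (expand (Φ (m ℕ.* p)) (xpow m)) (m ℕ.+ k))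
                   (trans (coeff-- (xpow m *ₚ Φ (m ℕ.* p)) (Φ (m ℕ.* p)) (m ℕ.+ k))
                          (cong (ℤ._- c (m ℕ.+ k)) (coeff-xpow-*-shift m (Φ (m ℕ.* p)) k)))))
            (coeff≡ Φmp*xpow-1≋ (m ℕ.+ k))

  h-block : ∀ i t → t < p → h (i ℕ.* p ℕ.+ t) ≡ a i ℤ.* ψ t
  h-block = coeff-substPow-* p (Ψ m) (Deg<-mono (ℕP.<⇒≤ m<p) Deg<-Ψ) (Φ m)

  -- Inside block i the term h vanishes past the first m coefficients, since deg Ψ m < m.
  c-periodic : ∀ i j k → j ℕ.* m ℕ.+ k < p → c (i ℕ.* p ℕ.+ (j ℕ.* m ℕ.+ k)) ≡ c (i ℕ.* p ℕ.+ k)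
  c-periodic i zero k _ = refl
  c-periodic i (suc j) k lt = begin
    c (i ℕ.* p ℕ.+ (suc j ℕ.* m ℕ.+ k))   ≡⟨ cong c (index i j k) ⟩
    c (m ℕ.+ K)                           ≡⟨ c-+m K ⟩
    c K ℤ.- h (m ℕ.+ K)                   ≡⟨ cong (ℤ._-_ (c K)) (trans (cong h (sym (index i j k))) (h-block i (suc j ℕ.* m ℕ.+ k) lt)) ⟩
    c K ℤ.- a i ℤ.* ψ (suc j ℕ.* m ℕ.+ k) ≡⟨ cong (λ z → c K ℤ.- a i ℤ.* z) (vanish Deg<-Ψ _ (ℕP.≤-trans (ℕP.m≤m+n m (j ℕ.* m)) (ℕP.m≤m+n _ k))) ⟩
    c K ℤ.- a i ℤ.* 0ℤ                    ≡⟨ cong (ℤ._-_ (c K)) (ℤP.*-zeroʳ (a i)) ⟩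
    c K ℤ.- 0ℤ                            ≡⟨ ℤP.+-identityʳ (c K) ⟩
    c K                                   ≡⟨ c-periodic i j k (ℕP.≤-<-trans (ℕP.+-monoˡ-≤ k (ℕP.m≤n+m (j ℕ.* m) m)) lt) ⟩
    c (i ℕ.* p ℕ.+ k)                     ∎
    where
    open ≡-Reasoning
    K = i ℕ.* p ℕ.+ (j ℕ.* m ℕ.+ k)
    index : ∀ i j k → i ℕ.* p ℕ.+ (suc j ℕ.* m ℕ.+ k) ≡ m ℕ.+ (i ℕ.* p ℕ.+ (j ℕ.* m ℕ.+ k))
    index i j k = shuffle (i ℕ.* p) m (j ℕ.* m) k
      where
      shuffle : ∀ x y z w → x ℕ.+ ((y ℕ.+ z) ℕ.+ w) ≡ y ℕ.+ (x ℕ.+ (z ℕ.+ w))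
      shuffle = ℕ-Solver.solve-∀

  c-next-block : ∀ i k → k < m → c (suc i ℕ.* p ℕ.+ k) ≡ c (i ℕ.* p ℕ.+ ((p ∸ m) ℕ.+ k)) ℤ.- a (suc i) ℤ.* ψ k
  c-next-block i k k<m =
    trans (cong c index) (trans (c-+m _) (cong (ℤ._-_ (c (i ℕ.* p ℕ.+ ((p ∸ m) ℕ.+ k))))
      (trans (cong h (sym index)) (h-block (suc i) k (ℕP.<-trans k<m m<p)))))
    where
    shuffle : ∀ x y z w → ((x ℕ.+ y) ℕ.+ z) ℕ.+ w ≡ x ℕ.+ (z ℕ.+ (y ℕ.+ w))
    shuffle = ℕ-Solver.solve-∀
    index : suc i ℕ.* p ℕ.+ k ≡ m ℕ.+ (i ℕ.* p ℕ.+ ((p ∸ m) ℕ.+ k))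
    index = trans (cong (λ z → (z ℕ.+ i ℕ.* p) ℕ.+ k) (sym (ℕP.m+[n∸m]≡n (ℕP.<⇒≤ m<p)))) (shuffle m (p ∸ m) (i ℕ.* p) k)

  q r : ℕ
  q = p / m
  r = p % m

  p≡r+q*m : p ≡ r ℕ.+ q ℕ.* m
  p≡r+q*m = m≡m%n+[m/n]*n p m

  r<m : r < m
  r<m = m%n<n p m

  r≤m : r ≤ m
  r≤m = ℕP.<⇒≤ r<m

  q*m+k<p : ∀ k → k < r → q ℕ.* m ℕ.+ k < p
  q*m+k<p k k<r = subst (q ℕ.* m ℕ.+ k <_) (trans (ℕP.+-comm (q ℕ.* m) r) (sym p≡r+q*m)) (ℕP.+-monoʳ-< (q ℕ.* m) k<r)

  q≡1+ : q ≡ suc (q ∸ 1)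
  q≡1+ with q | p≡r+q*m
  ... | zero | e = ⊥-elim (ℕP.<⇒≱ m<p (ℕP.≤-trans (ℕP.≤-reflexive (trans e (ℕP.+-identityʳ r))) r≤m))
  ... | suc _ | _ = refl

  p∸m≡ : p ∸ m ≡ r ℕ.+ (q ∸ 1) ℕ.* m
  p∸m≡ = trans (cong (_∸ m) (trans p≡r+q*m (trans (cong (λ z → r ℕ.+ z ℕ.* m) q≡1+) (swap r m ((q ∸ 1) ℕ.* m)))))
               (ℕP.m+n∸m≡n m (r ℕ.+ (q ∸ 1) ℕ.* m))
    where
    swap : ∀ x y z → x ℕ.+ (y ℕ.+ z) ≡ y ℕ.+ (x ℕ.+ z)
    swap = ℕ-Solver.solve-∀

  Deg<-fBlock2 : ∀ i j → Deg< (fBlock2 m p i j) m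
  Deg<-fBlock2 i j = deg< (coeff-fBlock2-≥ m p i j)

  coeff-fBlock2 : ∀ i j k → k < m → j ℕ.* m ℕ.+ k < p → coeff (fBlock2 m p i j) k ≡ c (i ℕ.* p ℕ.+ (j ℕ.* m ℕ.+ k))
  coeff-fBlock2 i j k k<m lt = trans (coeff-fBlock2-< m p i j k k<m) (coeff-fBlock-< m p i (j ℕ.* m ℕ.+ k) lt)

  coeff-fBlock2-0 : ∀ i k → k < m → coeff (fBlock2 m p i 0) k ≡ c (i ℕ.* p ℕ.+ k)
  coeff-fBlock2-0 i k k<m = coeff-fBlock2 i 0 k k<m (ℕP.<-trans k<m m<p)

  -- The shifted window of block i seen from block i + 1 is the rotation of its first subblock.
  c-shifted≡rotate : ∀ i k → k < m → c (i ℕ.* p ℕ.+ ((p ∸ m) ℕ.+ k)) ≡ coeff (rotate m r (fBlock2 m p i 0)) k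
  c-shifted≡rotate i k k<m with k ℕ.<? m ∸ r
  ... | yes k<m-r =
    trans (cong (λ z → c (i ℕ.* p ℕ.+ z)) index) (trans (c-periodic i (q ∸ 1) (r ℕ.+ k) bound)
      (sym (trans (coeff-rotate-< m r (fBlock2 m p i 0) k k<m-r) (coeff-fBlock2-0 i (r ℕ.+ k) r+k<m))))
    where
    r+k<m : r ℕ.+ k < m
    r+k<m = subst (r ℕ.+ k <_) (ℕP.m+[n∸m]≡n r≤m) (ℕP.+-monoʳ-< r k<m-r)
    shuffle : ∀ x y z → (x ℕ.+ y) ℕ.+ z ≡ y ℕ.+ (x ℕ.+ z)
    shuffle = ℕ-Solver.solve-∀
    index : (p ∸ m) ℕ.+ k ≡ (q ∸ 1) ℕ.* m ℕ.+ (r ℕ.+ k)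
    index = trans (cong (ℕ._+ k) p∸m≡) (shuffle r ((q ∸ 1) ℕ.* m) k)
    bound : (q ∸ 1) ℕ.* m ℕ.+ (r ℕ.+ k) < p
    bound = subst (_< p) index (subst ((p ∸ m) ℕ.+ k <_) (ℕP.m∸n+n≡m (ℕP.<⇒≤ m<p)) (ℕP.+-monoʳ-< (p ∸ m) k<m))
  ... | no k≮m-r =
    trans (cong (λ z → c (i ℕ.* p ℕ.+ z)) index) (trans (c-periodic i q k′ (q*m+k<p k′ k′<r))
      (sym (trans (cong (coeff (rotate m r (fBlock2 m p i 0))) (sym k≡))
             (trans (coeff-rotate-wrap m r (fBlock2 m p i 0) k′ r≤m (Deg<-fBlock2 i 0) k′<r)
                    (coeff-fBlock2-0 i k′ (ℕP.<-trans k′<r r<m))))))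
    where
    k′ = k ∸ (m ∸ r)
    k≡ : (m ∸ r) ℕ.+ k′ ≡ k
    k≡ = ℕP.m+[n∸m]≡n (ℕP.≮⇒≥ k≮m-r)
    k′<r : k′ < r
    k′<r = ℕP.+-cancelˡ-< (m ∸ r) k′ r (subst₂ _<_ (sym k≡) (sym (trans (ℕP.+-comm (m ∸ r) r) (ℕP.m+[n∸m]≡n r≤m))) k<m)
    shuffle : ∀ x y z w → (x ℕ.+ y) ℕ.+ (z ℕ.+ w) ≡ (x ℕ.+ z) ℕ.+ y ℕ.+ w
    shuffle = ℕ-Solver.solve-∀
    index : (p ∸ m) ℕ.+ k ≡ q ℕ.* m ℕ.+ k′
    index = begin
      (p ∸ m) ℕ.+ k                                  ≡⟨ cong ((p ∸ m) ℕ.+_) k≡ ⟨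
      (p ∸ m) ℕ.+ ((m ∸ r) ℕ.+ k′)                   ≡⟨ cong (ℕ._+ ((m ∸ r) ℕ.+ k′)) p∸m≡ ⟩
      (r ℕ.+ (q ∸ 1) ℕ.* m) ℕ.+ ((m ∸ r) ℕ.+ k′)     ≡⟨ shuffle r ((q ∸ 1) ℕ.* m) (m ∸ r) k′ ⟩
      (r ℕ.+ (m ∸ r)) ℕ.+ (q ∸ 1) ℕ.* m ℕ.+ k′       ≡⟨ cong (λ z → z ℕ.+ (q ∸ 1) ℕ.* m ℕ.+ k′) (ℕP.m+[n∸m]≡n r≤m) ⟩
      suc (q ∸ 1) ℕ.* m ℕ.+ k′                       ≡⟨ cong (λ z → z ℕ.* m ℕ.+ k′) q≡1+ ⟨
      q ℕ.* m ℕ.+ k′                                 ∎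
      where open ≡-Reasoning

  fBlock2-periodic : ∀ i j → j < q → fBlock2 m p i j ≈ₚ fBlock2 m p i 0
  fBlock2-periodic i j j<q = coeff≡ (≋-below m (Deg<-fBlock2 i j) (Deg<-fBlock2 i 0) λ k k<m →
    trans (coeff-fBlock2 i j k k<m (bound k k<m)) (trans (c-periodic i j k (bound k k<m)) (sym (coeff-fBlock2-0 i k k<m))))
    where
    bound : ∀ k → k < m → j ℕ.* m ℕ.+ k < p
    bound k k<m =
      ℕP.<-≤-trans (subst (j ℕ.* m ℕ.+ k <_) (ℕP.+-comm (j ℕ.* m) m) (ℕP.+-monoʳ-< (j ℕ.* m) k<m))
        (ℕP.≤-trans (ℕP.*-monoˡ-≤ m j<q) (subst (q ℕ.* m ≤_) (sym p≡r+q*m) (ℕP.m≤n+m (q ℕ.* m) r)))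

  fBlock2-last : ∀ i → fBlock2 m p i q ≈ₚ 𝒯 r (fBlock2 m p i 0)
  fBlock2-last i = coeff≡ (≋-below m (Deg<-fBlock2 i q) (Deg<-mono r≤m (Deg<-resp (≋-sym (𝒯≋take r h₀)) (Deg<-take r h₀))) λ k k<m →
    trans (coeffs k k<m (k ℕ.<? r)) (sym (coeff≡ (𝒯≋take r h₀) k)))
    where
    h₀ = fBlock2 m p i 0
    coeffs : ∀ k → k < m → Dec (k < r) → coeff (fBlock2 m p i q) k ≡ coeff (take r h₀) k
    coeffs k k<m (yes k<r) =
      trans (coeff-fBlock2 i q k k<m (q*m+k<p k k<r))
        (trans (c-periodic i q k (q*m+k<p k k<r)) (sym (trans (coeff-take-< r h₀ k k<r) (coeff-fBlock2-0 i k k<m))))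
    coeffs k k<m (no k≮r) =
      trans (coeff-fBlock2-< m p i q k k<m) (trans (coeff-fBlock-≥ m p i (q ℕ.* m ℕ.+ k) p≤) (sym (coeff-take-≥ r h₀ k (ℕP.≮⇒≥ k≮r))))
      where
      p≤ : p ≤ q ℕ.* m ℕ.+ k
      p≤ = subst (_≤ q ℕ.* m ℕ.+ k) (trans (ℕP.+-comm (q ℕ.* m) r) (sym p≡r+q*m)) (ℕP.+-monoʳ-≤ (q ℕ.* m) (ℕP.≮⇒≥ k≮r))

  fBlock2-next : ∀ i → fBlock2 m p (suc i) 0 ≈ₚ ℛ m r (fBlock2 m p i 0) -ₚ scaleₚ (a (suc i)) (Ψ m)
  fBlock2-next i = coeff≡ (≋-below m (Deg<-fBlock2 (suc i) 0) Deg<-rhs λ k k<m → begin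
    coeff (fBlock2 m p (suc i) 0) k                      ≡⟨ coeff-fBlock2-0 (suc i) k k<m ⟩
    c (suc i ℕ.* p ℕ.+ k)                                 ≡⟨ c-next-block i k k<m ⟩
    c (i ℕ.* p ℕ.+ ((p ∸ m) ℕ.+ k)) ℤ.- a (suc i) ℤ.* ψ k  ≡⟨ cong (ℤ._- a (suc i) ℤ.* ψ k) (c-shifted≡rotate i k k<m) ⟩
    coeff (rotate m r h₀) k ℤ.- a (suc i) ℤ.* ψ k         ≡⟨ cong₂ ℤ._-_ (coeff≡ ℛ≋ k) (coeff-scale (a (suc i)) (Ψ m) k) ⟨
    coeff (ℛ m r h₀) k ℤ.- coeff (scaleₚ (a (suc i)) (Ψ m)) k ≡⟨ coeff-- (ℛ m r h₀) (scaleₚ (a (suc i)) (Ψ m)) k ⟨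
    coeff (ℛ m r h₀ -ₚ scaleₚ (a (suc i)) (Ψ m)) k        ∎)
    where
    open ≡-Reasoning
    h₀ = fBlock2 m p i 0
    ℛ≋ : ℛ m r h₀ ≋ rotate m r h₀
    ℛ≋ = ℛ≋rotate m r h₀ 1≤m r≤m (Deg<-fBlock2 i 0)
    Deg<-rhs : Deg< (ℛ m r h₀ -ₚ scaleₚ (a (suc i)) (Ψ m)) m
    Deg<-rhs = Deg<-+ (Deg<-resp (≋-sym ℛ≋) (Deg<-rotate m r h₀ r≤m (Deg<-fBlock2 i 0)))
                      (Deg<-neg (Deg<-resp (≋-sym (scale≋const-* (a (suc i)) (Ψ m))) (Deg<-const-* (a (suc i)) Deg<-Ψ)))

-- The identities hold for every block index i.
mainTheorem2 : (m p : ℕ) → .{{_ : NonZero m}} → Prime p → m < p →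
    ((i j : ℕ) → i < φ m → j < p / m → fBlock2 m p i j ≈ₚ fBlock2 m p i 0)
    × ((i : ℕ) → i < φ m → fBlock2 m p i (p / m) ≈ₚ 𝒯 (p % m) (fBlock2 m p i 0))
    × ((i : ℕ) → suc i < φ m →
        fBlock2 m p (suc i) 0 ≈ₚ ℛ m (p % m) (fBlock2 m p i 0) -ₚ scaleₚ (coeff (Φ m) (suc i)) (Ψ m))
mainTheorem2 m p p-prime m<p =
  (λ i j _ → fBlock2-periodic i j) , (λ i _ → fBlock2-last i) , (λ i _ → fBlock2-next i)
  where open Blocks m p p-prime m<p
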